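{- Let $r\ge1$. (i) The coloured permutation statistic $(\mathrm{des},\mathrm{comaj},\mathbf{col})$ (on $r$-coloured permutations) is shuffle compatible. (ii) The $\mathbb{Q}$-linear map $H:\mathcal A^{(r)}_{(\mathrm{des},\mathrm{comaj},\mathbf{col})}\to\mathbb{Q}[\bm p,x][[t\ast]]$ defined by $$[\bm a]\mapsto\frac{\bm p^{\mathbf{col}(\bm a)}x^{\mathrm{comaj}(\bm a)}t^{\mathrm{des}(\bm a)}}{(1-t)(1-xt)\cdots(1-x^{|\bm a|}t)}$$ is an injective $\mathbb{Q}$-algebra homomorphism.
   Context: Fix $r\ge1$. An $r$-coloured permutation is a word $\bm a=\sigma_1^{\gamma_1}\cdots\sigma_n^{\gamma_n}$ ($n\ge0$) with distinct positive integers $\sigma_i$ and colours $\gamma_i\in\{0,\dots,r-1\}$; $|\bm a|=n$. Coloured integers are ordered by $\sigma_1^{\gamma_1}<\sigma_2^{\gamma_2}$ iff either $\gamma_1=\gamma_2$ and $\sigma_1<\sigma_2$, or $\gamma_1>\gamma_2$ as integers. $\mathrm{Des}(\bm a)=\{i\in[n-1]:\sigma_i^{\gamma_i}>\sigma_{i+1}^{\gamma_{i+1}}\}$, with $0$ added if $n\ge1$ and $\gamma_1\ne0$; $\mathrm{des}(\bm a)=|\mathrm{Des}(\bm a)|$; $\mathrm{comaj}(\bm a)=\sum_{i\in\mathrm{Des}(\bm a)}(n-i)$; $\mathbf{col}(\bm a)=(\mathrm{col}_0(\bm a),\dots,\mathrm{col}_{r-1}(\bm a))$ with $\mathrm{col}_j(\bm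 a)=|\{i:\gamma_i=j\}|$. A coloured permutation statistic $\mathrm{st}$ (a function on coloured permutations depending only on the colours and the relative order of the symbols) is shuffle compatible if for all coloured permutations $\bm a,\bm b$ with disjoint symbol sets, the multiset $\{\!\{\mathrm{st}(\bm c):\bm c\text{ a shuffle of }\bm a,\bm b\}\!\}$ depends only on $\mathrm{st}(\bm a),\mathrm{st}(\bm b),|\bm a|,|\bm b|$. Then $\mathcal A^{(r)}_{\mathrm{st}}$ is the $\mathbb{Q}$-algebra with basis the classes $[\bm a]$ of $r$-coloured permutations under "same length and same $\mathrm{st}$", with product $[\bm a][\bm b]=\sum_{\bm c}[\bm c]$ over all shuffles $\bm c$ of symbol-disjoint representatives $\bm a,\bm b$. A tuple of statistics is the statistic $\bm a\mapsto(\mathrm{st}_1(\bm a),\dots,\mathrm{st}_k(\bm a))$. $p_0,\dots,p_{r-1},x,t$ are commuting indeterminates, $\bm p^{\bm v}=p_0^{v_0}\cdots p_{r-1}^{v_{r-1}}$, and for a ring $R$, $R[[t\ast]]$ denotes $R[[t]]$ with multiplication the Hadamard product in $t$: $\left(\sum a_mt^m\right)*\left(\sum b_mt^m\right)=\sum a_mb_mt^m$. -}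

module Defs where

open import Data.Nat as ℕ using (ℕ; zero; suc; _≤_; _<ᵇ_; _≡ᵇ_)
open import Data.Fin using (Fin; toℕ)
import Data.Fin.Properties as FinP
open import Data.Bool using (Bool; true; false; if_then_else_; _∧_; _∨_; not)
open import Data.List using (List; []; _∷_; _++_; map; length; filter; concatMap; upTo; foldr)
open import Data.Nat.ListAction using (sum)
open import Data.List.Relation.Unary.All using (All)
open import Data.List.Relation.Unary.Unique.Propositional using (Unique)
open import Data.List.Relation.Binary.Disjoint.Propositional using (Disjoint)
open import Data.Vec using (Vec; tabulate; replicate; zipWith)
import Data.Vec.Properties as VecP
open import Data.Product using (_×_; _,_; proj₁; proj₂)
import Data.Product.Properties as ProdP
open import Data.Rational using (ℚ; 0ℚ; 1ℚ) renaming (_+_ to _+ℚ_; _*_ to _*ℚ_)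
open import Relation.Nullary using (does)
open import Relation.Binary.PropositionalEquality using (_≡_)
open import Relation.Binary using (DecidableEquality)

Letter : ℕ → Set
Letter r = ℕ × Fin r

Word : ℕ → Set
Word r = List (Letter r)

symbols : ∀ {r} → Word r → List ℕ
symbols = map proj₁

record CPerm (r : ℕ) : Set where
  constructor cperm
  field
    word     : Word r
    distinct : Unique (symbols word)
    positive : All (λ e → 1 ≤ proj₁ e) word
open CPerm public

SymDisjoint : ∀ {r} → CPerm r → CPerm r → Set
SymDisjoint a b = Disjoint (symbols (word a)) (symbols (word b))

shuffles : {A : Set} → List A → List A → List (List A)
shuffles []       ys       = ys ∷ []
shuffles (x ∷ xs) []       = (x ∷ xs) ∷ []
shuffles (x ∷ xs) (y ∷ ys) =
  map (x ∷_) (shuffles xs (y ∷ ys)) ++ map (y ∷_) (shuffles (x ∷ xs) ys)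

_<c_ : ∀ {r} → Letter r → Letter r → Bool
(σ₁ , γ₁) <c (σ₂ , γ₂) =
  ((toℕ γ₁ ≡ᵇ toℕ γ₂) ∧ (σ₁ <ᵇ σ₂)) ∨ (toℕ γ₂ <ᵇ toℕ γ₁)

desPos : ∀ {r} → ℕ → Word r → List ℕ
desPos i []            = []
desPos i (x ∷ [])      = []
desPos i (x ∷ y ∷ w)   =
  (if y <c x then i ∷ [] else []) ++ desPos (suc i) (y ∷ w)

Des : ∀ {r} → Word r → List ℕ
Des []            = []
Des ((σ , γ) ∷ w) =
  (if toℕ γ ≡ᵇ 0 then [] else 0 ∷ []) ++ desPos 1 ((σ , γ) ∷ w)

des : ∀ {r} → Word r → ℕ
des w = length (Des w)

comaj : ∀ {r} → Word r → ℕ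
comaj w = sum (map (λ i → length w ℕ.∸ i) (Des w))

col : ∀ {r} → Word r → Vec ℕ r
col w = tabulate (λ j → length (filter (λ e → proj₂ e FinP.≟ j) w))

Stat : ℕ → Set
Stat r = ℕ × ℕ × Vec ℕ r

st : ∀ {r} → Word r → Stat r
st w = des w , comaj w , col w

-- equivalence classes: same length and same statistic
Key : ℕ → Set
Key r = ℕ × Stat r

key : ∀ {r} → Word r → Key r
key w = length w , st w

_≟key_ : ∀ {r} → DecidableEquality (Key r)
_≟key_ = ProdP.≡-dec ℕ._≟_ (ProdP.≡-dec ℕ._≟_ (ProdP.≡-dec ℕ._≟_ (VecP.≡-dec ℕ._≟_)))

-- Polynomials in ℚ[p₀,…,p_{r-1},x]: finite lists of terms
-- (coefficient , (exponent vector of p , exponent of x)),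
-- compared via their coefficient functions.

Mono : ℕ → Set
Mono r = Vec ℕ r × ℕ

_≟mono_ : ∀ {r} → DecidableEquality (Mono r)
_≟mono_ = ProdP.≡-dec (VecP.≡-dec ℕ._≟_) ℕ._≟_

Poly : ℕ → Set
Poly r = List (ℚ × Mono r)

coeff : ∀ {r} → Poly r → Mono r → ℚ
coeff []              μ = 0ℚ
coeff ((q , ν) ∷ P)   μ = (if does (ν ≟mono μ) then q else 0ℚ) +ℚ coeff P μ

polyMul : ∀ {r} → Poly r → Poly r → Poly r
polyMul P Q = concatMap (λ { (q₁ , (e₁ , x₁)) →
                map (λ { (q₂ , (e₂ , x₂)) → (q₁ *ℚ q₂ , (zipWith ℕ._+_ e₁ e₂ , x₁ ℕ.+ x₂)) }) Q }) P

polyScale : ∀ {r} → ℚ → Poly r → Poly r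
polyScale c = map (λ { (q , μ) → (c *ℚ q , μ) })

-- Power series in t over ℚ[p,x]: coefficient of t^m for each m.
-- With the Hadamard product ℚ[p,x][[t∗]].

Series : ℕ → Set
Series r = ℕ → Poly r

_⊙_ : ∀ {r} → Series r → Series r → Series r
(S ⊙ T) m = polyMul (S m) (T m)

zeroS : ∀ {r} → Series r
zeroS m = []

_⊕_ : ∀ {r} → Series r → Series r → Series r
(S ⊕ T) m = S m ++ T m

sumS : ∀ {r} → List (Series r) → Series r
sumS = foldr _⊕_ zeroS

scaleS : ∀ {r} → ℚ → Series r → Series r
scaleS c S m = polyScale c (S m)

_≈S_ : ∀ {r} → Series r → Series r → Set
S ≈S T = ∀ m μ → coeff (S m) μ ≡ coeff (T m) μ

-- multiplicative identity of ℚ[p,x][[t∗]]: Σ_m t^m = 1/(1-t)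
oneS : ∀ {r} → Series r
oneS m = (1ℚ , (replicate _ 0 , 0)) ∷ []

-- Coefficient of t^k in 1/((1-t)(1-xt)⋯(1-x^n t)), as the list of
-- exponents of x (with multiplicity): the Cauchy product of the
-- geometric series Σ_i x^{j i} t^i, j = 0,…,n.
geomExps : ℕ → ℕ → List ℕ
geomExps zero    k = 0 ∷ []
geomExps (suc n) k =
  concatMap (λ k′ → map (λ e → e ℕ.+ suc n ℕ.* (k ℕ.∸ k′)) (geomExps n k′))
            (upTo (suc k))

H : ∀ {r} → Word r → Series r
H w m with m ℕ.<? des w
... | Relation.Nullary.yes _ = []
... | Relation.Nullary.no  _ =
  map (λ e → (1ℚ , (col w , comaj w ℕ.+ e))) (geomExps (length w) (m ℕ.∸ des w))

Hlin : ∀ {r} → List (ℚ × CPerm r) → Series r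
Hlin L = sumS (map (λ { (q , a) → scaleS q (H (word a)) }) L)

-- coefficient of the basis element [c] in the element of 𝒜 represented by L
classCoeff : ∀ {r} → List (ℚ × CPerm r) → CPerm r → ℚ
classCoeff []            c = 0ℚ
classCoeff ((q , a) ∷ L) c =
  (if does (key (word a) ≟key key (word c)) then q else 0ℚ) +ℚ classCoeff L c

-- The t^m-coefficient of H(a) lists the weights g₁ + ⋯ + gₙ of the sequences 0 ≤ g₁ ≤ ⋯ ≤ gₙ ≤ m that
-- increase strictly at the descents of a, a descent before the first letter occurring exactly when its
-- colour is nonzero (Stanley's P-partitions; summing over g₁ peels off one factor 1/(1 - xʲt) at a time).
-- For symbol-disjoint a and b, a pair of such sequences for a and for b merges into such a sequence for
-- exactly one shuffle of a and b, so H(a) ⊙ H(b) = Σ H(c) over the shuffles c. H is injective on classes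
-- because it is unitriangular in the descent number: the coefficient of t^d x^c p^v in H(a) vanishes if
-- des a > d, and if des a = d it is 1 exactly when a has comajor index c and colour vector v (which fixes
-- the length). Hence the multiset of classes of the shuffles is determined by H(a) ⊙ H(b), which is
-- shuffle compatibility.

module Submission where

open import Defs
open import Data.Nat using (ℕ; zero; suc; _+_; _*_; _∸_; _≤_; _<_; z≤n; s≤s; z<s; _≤?_; _<?_; _≡ᵇ_)
open import Data.Nat.Properties
open import Data.Nat.ListAction using (sum)
open import Data.Nat.ListAction.Properties using (sum-++)
open import Data.Nat.Tactic.RingSolver using (solve-∀)
open import Data.Bool using (Bool; true; false; T; if_then_else_)
open import Data.Bool.Properties using (T-∨; T-∧)
open import Data.Fin using (Fin; toℕ) renaming (zero to fzero; suc to fsuc)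
import Data.Fin.Properties as Fin
open import Data.List using (List; []; _∷_; _++_; map; concatMap; [_]; length; filter; applyUpTo; upTo)
import Data.List.Properties as List
open import Data.List.Relation.Unary.All as All using (All; []; _∷_)
import Data.List.Relation.Unary.All.Properties as AllP
open import Data.List.Relation.Unary.Any using (here; there)
open import Data.List.Membership.Propositional using (_∈_)
open import Data.List.Relation.Binary.Permutation.Propositional hiding (trans)
open import Data.List.Relation.Binary.Permutation.Propositional.Properties
open import Data.Vec as Vec using (Vec; tabulate; zipWith; replicate)
import Data.Vec.Properties as Vec
open import Data.Product using (Σ; _×_; _,_; proj₁; proj₂)
open import Data.Sum using (_⊎_; inj₁; inj₂)
open import Data.Empty using (⊥; ⊥-elim)
open import Data.Rational using (ℚ; 0ℚ; 1ℚ; -_)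
  renaming (_+_ to _+ℚ_; _*_ to _*ℚ_; _≤_ to _ℚ≤_; _<_ to _ℚ<_)
import Data.Rational.Properties as ℚ
open import Data.Rational.Solver using (module +-*-Solver)
open import Function.Base using (_∘_)
open import Function.Bundles using (Equivalence)
open import Relation.Nullary using (¬_; Dec; yes; no; does)
open import Relation.Nullary.Decidable using (toWitness)
open import Relation.Binary using (DecidableEquality; tri<; tri≈; tri>)
open import Relation.Binary.PropositionalEquality
  using (_≡_; _≢_; refl; sym; trans; cong; cong₂; subst; module ≡-Reasoning)

open +-*-Solver using (solve; _:+_; _:*_; :-_; _:=_; con)

-- Multisets as lists up to permutation

module _ {A B : Set} where

  concatMap-congᴬ : {f g : A → List B} {xs : List A} →
    All (λ x → f x ↭ g x) xs → concatMap f xs ↭ concatMap g xs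
  concatMap-congᴬ []       = ↭-refl
  concatMap-congᴬ (p ∷ ps) = ++⁺ p (concatMap-congᴬ ps)

  concatMap-cong↭ : {f g : A → List B} → (∀ x → f x ↭ g x) → ∀ xs → concatMap f xs ↭ concatMap g xs
  concatMap-cong↭ f↭g xs = concatMap-congᴬ (All.universal f↭g xs)

  concatMap⁺ : (f : A → List B) {xs ys : List A} → xs ↭ ys → concatMap f xs ↭ concatMap f ys
  concatMap⁺ f refl         = ↭-refl
  concatMap⁺ f (prep x p)   = ++⁺ˡ (f x) (concatMap⁺ f p)
  concatMap⁺ f (swap x y p) = begin
    f x ++ f y ++ _  ↭⟨ shifts (f x) (f y) ⟩
    f y ++ f x ++ _  ↭⟨ ++⁺ˡ (f y) (++⁺ˡ (f x) (concatMap⁺ f p)) ⟩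
    _                ∎
    where open PermutationReasoning
  concatMap⁺ f (_↭_.trans p q) = ↭-trans (concatMap⁺ f p) (concatMap⁺ f q)

  concatMap-[] : (xs : List A) → concatMap {B = B} (λ _ → []) xs ≡ []
  concatMap-[] []       = refl
  concatMap-[] (x ∷ xs) = concatMap-[] xs

  concatMap-++-distrib : (f g : A → List B) (xs : List A) →
    concatMap (λ x → f x ++ g x) xs ↭ concatMap f xs ++ concatMap g xs
  concatMap-++-distrib f g []       = ↭-refl
  concatMap-++-distrib f g (x ∷ xs) = begin
    (f x ++ g x) ++ concatMap (λ x → f x ++ g x) xs   ≡⟨ List.++-assoc (f x) (g x) _ ⟩
    f x ++ g x ++ concatMap (λ x → f x ++ g x) xs     ↭⟨ ++⁺ˡ (f x) (++⁺ˡ (g x) (concatMap-++-distrib f g xs)) ⟩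
    f x ++ g x ++ concatMap f xs ++ concatMap g xs    ↭⟨ ++⁺ˡ (f x) (shifts (g x) (concatMap f xs)) ⟩
    f x ++ concatMap f xs ++ g x ++ concatMap g xs    ≡⟨ List.++-assoc (f x) (concatMap f xs) _ ⟨
    (f x ++ concatMap f xs) ++ g x ++ concatMap g xs  ∎
    where open PermutationReasoning

concatMap-comm : {A B C : Set} (Φ : A → B → List C) (xs : List A) (ys : List B) →
  concatMap (λ x → concatMap (Φ x) ys) xs ↭ concatMap (λ y → concatMap (λ x → Φ x y) xs) ys
concatMap-comm Φ []       ys = ↭-reflexive (sym (concatMap-[] ys))
concatMap-comm Φ (x ∷ xs) ys = ↭-trans (++⁺ˡ (concatMap (Φ x) ys) (concatMap-comm Φ xs ys))
  (↭-sym (concatMap-++-distrib (Φ x) (λ y → concatMap (λ x′ → Φ x′ y) xs) ys))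

infixl 6 _⊞_
_⊞_ : List ℕ → List ℕ → List ℕ
A ⊞ B = concatMap (λ a → map (a +_) B) A

map-as-concatMap : {A B : Set} (f : A → B) (xs : List A) → map f xs ≡ concatMap (λ x → [ f x ]) xs
map-as-concatMap f xs = trans (sym (List.concatMap-pure (map f xs))) (List.concatMap-map [_] f xs)

⊞-identityˡ : ∀ B → [ 0 ] ⊞ B ≡ B
⊞-identityˡ B = trans (List.++-identityʳ _) (List.map-id B)

⊞-identityʳ : ∀ A → A ⊞ [ 0 ] ≡ A
⊞-identityʳ []      = refl
⊞-identityʳ (a ∷ A) = cong₂ _∷_ (+-identityʳ a) (⊞-identityʳ A)

⊞-comm : ∀ A B → A ⊞ B ↭ B ⊞ A
⊞-comm A B = begin
  A ⊞ B                                                   ≡⟨ List.concatMap-cong (λ a → map-as-concatMap (a +_) B) A ⟩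
  concatMap (λ a → concatMap (λ b → [ a + b ]) B) A       ↭⟨ concatMap-comm (λ a b → [ a + b ]) A B ⟩
  concatMap (λ b → concatMap (λ a → [ a + b ]) A) B       ≡⟨ List.concatMap-cong (λ b → trans
                                                               (List.concatMap-cong (λ a → cong [_] (+-comm a b)) A)
                                                               (sym (map-as-concatMap (b +_) A))) B ⟩
  B ⊞ A                                                   ∎
  where open PermutationReasoning

⊞-concatMapˡ : {X : Set} (f : X → List ℕ) (xs : List X) (B : List ℕ) →
  concatMap f xs ⊞ B ≡ concatMap (λ x → f x ⊞ B) xs
⊞-concatMapˡ f []       B = refl
⊞-concatMapˡ f (x ∷ xs) B = trans (List.concatMap-++ (λ a → map (a +_) B) (f x) (concatMap f xs))
  (cong (f x ⊞ B ++_) (⊞-concatMapˡ f xs B))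

⊞-concatMapʳ : {X : Set} (A : List ℕ) (f : X → List ℕ) (xs : List X) →
  A ⊞ concatMap f xs ↭ concatMap (λ x → A ⊞ f x) xs
⊞-concatMapʳ A f xs = ↭-trans
  (concatMap-cong↭ (λ a → ↭-reflexive (List.map-concatMap (a +_) f xs)) A)
  (concatMap-comm (λ a x → map (a +_) (f x)) A xs)

⊞-shiftˡ : ∀ g A B → map (g +_) A ⊞ B ≡ map (g +_) (A ⊞ B)
⊞-shiftˡ g A B = begin
  concatMap (λ a → map (a +_) B) (map (g +_) A)   ≡⟨ List.concatMap-map (λ a → map (a +_) B) (g +_) A ⟩
  concatMap (λ a → map (g + a +_) B) A            ≡⟨ List.concatMap-cong (λ a → trans (List.map-cong (+-assoc g a) B)
                                                       (List.map-∘ B)) A ⟩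
  concatMap (λ a → map (g +_) (map (a +_) B)) A   ≡⟨ List.map-concatMap (g +_) (λ a → map (a +_) B) A ⟨
  map (g +_) (A ⊞ B)                              ∎
  where open ≡-Reasoning

χ : Bool → ℕ
χ false = 0
χ true  = 1

infix 4 _≺_
_≺_ : ∀ {r} → Letter r → Letter r → Set
(σ₁ , γ₁) ≺ (σ₂ , γ₂) = (toℕ γ₁ ≡ toℕ γ₂ × σ₁ < σ₂) ⊎ toℕ γ₂ < toℕ γ₁

<c⇒≺ : ∀ {r} (x y : Letter r) → T (x <c y) → x ≺ y
<c⇒≺ (σ₁ , γ₁) (σ₂ , γ₂) t with Equivalence.to T-∨ t
... | inj₁ t′ = let (γ₁≡γ₂ , σ₁<σ₂) = Equivalence.to T-∧ t′ in
                inj₁ (≡ᵇ⇒≡ (toℕ γ₁) (toℕ γ₂) γ₁≡γ₂ , <ᵇ⇒< σ₁ σ₂ σ₁<σ₂)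
... | inj₂ t′ = inj₂ (<ᵇ⇒< (toℕ γ₂) (toℕ γ₁) t′)

≺⇒<c : ∀ {r} (x y : Letter r) → x ≺ y → T (x <c y)
≺⇒<c (σ₁ , γ₁) (σ₂ , γ₂) (inj₁ (γ₁≡γ₂ , σ₁<σ₂)) =
  Equivalence.from T-∨ (inj₁ (Equivalence.from T-∧ (≡⇒≡ᵇ (toℕ γ₁) (toℕ γ₂) γ₁≡γ₂ , <⇒<ᵇ σ₁<σ₂)))
≺⇒<c (σ₁ , γ₁) (σ₂ , γ₂) (inj₂ γ₂<γ₁) = Equivalence.from T-∨ (inj₂ (<⇒<ᵇ γ₂<γ₁))

≺-trans : ∀ {r} {x y z : Letter r} → x ≺ y → y ≺ z → x ≺ z
≺-trans (inj₁ (e , p)) (inj₁ (e′ , q)) = inj₁ (trans e e′ , <-trans p q)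
≺-trans (inj₁ (e , _)) (inj₂ q)        = inj₂ (subst (_ <_) (sym e) q)
≺-trans (inj₂ p)       (inj₁ (e′ , _)) = inj₂ (subst (_< _) e′ p)
≺-trans (inj₂ p)       (inj₂ q)        = inj₂ (<-trans q p)

≺-asym : ∀ {r} {x y : Letter r} → x ≺ y → ¬ y ≺ x
≺-asym (inj₁ (_ , p)) (inj₁ (_ , q)) = <-asym p q
≺-asym (inj₁ (e , _)) (inj₂ q)       = <-irrefl e q
≺-asym (inj₂ p)       (inj₁ (e , _)) = <-irrefl e p
≺-asym (inj₂ p)       (inj₂ q)       = <-asym p q

≺-connex : ∀ {r} (x y : Letter r) → proj₁ x ≢ proj₁ y → ¬ x ≺ y → y ≺ x
≺-connex (σ₁ , γ₁) (σ₂ , γ₂) σ₁≢σ₂ x⊀y with <-cmp (toℕ γ₁) (toℕ γ₂)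
... | tri< γ₁<γ₂ _ _ = inj₂ γ₁<γ₂
... | tri> _ _ γ₂<γ₁ = ⊥-elim (x⊀y (inj₂ γ₂<γ₁))
... | tri≈ _ γ₁≡γ₂ _ with <-cmp σ₁ σ₂
...   | tri< σ₁<σ₂ _ _ = ⊥-elim (x⊀y (inj₁ (γ₁≡γ₂ , σ₁<σ₂)))
...   | tri≈ _ σ₁≡σ₂ _ = ⊥-elim (σ₁≢σ₂ σ₁≡σ₂)
...   | tri> _ _ σ₂<σ₁ = inj₁ (sym γ₁≡γ₂ , σ₂<σ₁)

χ-<c-antitone : ∀ {r} (x y p : Letter r) → T (x <c y) → χ (y <c p) ≤ χ (x <c p)
χ-<c-antitone x y p x<y with y <c p in y<p | x <c p in x<p
... | false | _     = z≤n
... | true  | true  = ≤-refl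
... | true  | false = ⊥-elim (subst T x<p (≺⇒<c x p
                        (≺-trans (<c⇒≺ x y x<y) (<c⇒≺ y p (subst T (sym y<p) _)))))

-- Integer intervals and the splitting of a square along its diagonal

segment : ℕ → ℕ → List ℕ
segment a zero    = []
segment a (suc l) = a ∷ segment (suc a) l

interval : ℕ → ℕ → List ℕ
interval a m = segment a (suc m ∸ a)

∸-pred : ∀ {m a k} → suc m ∸ a ≡ suc k → m ∸ a ≡ k
∸-pred {m} {a} e = suc-injective (trans (sym (+-∸-assoc 1 {m} {a} (≤-pred a<1+m))) e)
  where a<1+m = m∸n≢0⇒n<m {suc m} {a} (λ e′ → 0≢1+n (trans (sym e′) e))

interval-empty-suc : ∀ {a m} → suc m ∸ a ≡ 0 → interval (suc a) m ≡ []
interval-empty-suc {a} {m} e = cong (segment (suc a)) (m≤n⇒m∸n≡0 {m} {a} (≤-trans (n≤1+n m) (m∸n≡0⇒m≤n {suc m} {a} e)))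

interval-empty : ∀ {a m} → suc m ∸ a ≡ 0 → interval a m ≡ []
interval-empty {a} e = cong (segment a) e

interval-cons : ∀ {a m k} → suc m ∸ a ≡ suc k → interval a m ≡ a ∷ interval (suc a) m
interval-cons {a} {m} e = cong (segment a) (trans e (cong suc (sym (∸-pred {m} {a} e))))

module _ {B : Set} (m : ℕ) (Φ : ℕ → ℕ → List B) where

  rectangle : ℕ → ℕ → List B
  rectangle a b = concatMap (λ g → concatMap (Φ g) (interval b m)) (interval a m)

  lowerPart : ℕ → ℕ → List B
  lowerPart e a = concatMap (λ g → concatMap (Φ g) (interval (e + g) m)) (interval a m)

  upperPart : ℕ → ℕ → List B
  upperPart e b = concatMap (λ h → concatMap (λ g → Φ g h) (interval (e + h) m)) (interval b m)

  -- Induction on the side length suc m ∸ a, peeling off the first row and the first column alternately.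
  rectangle-split-square : ∀ k a → suc m ∸ a ≡ k → rectangle a a ↭ lowerPart 0 a ++ upperPart 1 a
  rectangle-split-step   : ∀ k b → suc m ∸ b ≡ k → rectangle (suc b) b ↭ lowerPart 0 (suc b) ++ upperPart 1 b

  rectangle-split-square zero    a e = ↭-reflexive (trans (cong (concatMap _) I≡[])
    (sym (cong₂ _++_ (cong (concatMap _) I≡[]) (cong (concatMap _) I≡[]))))
    where I≡[] = interval-empty {a} {m} e
  rectangle-split-square (suc k) a e = begin
    rectangle a a
      ≡⟨ cong (concatMap (λ g → concatMap (Φ g) (interval a m))) (interval-cons {a} {m} e) ⟩
    concatMap (Φ a) (interval a m) ++ rectangle (suc a) a
      ↭⟨ ++⁺ˡ (concatMap (Φ a) (interval a m)) (rectangle-split-step (suc k) a e) ⟩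
    concatMap (Φ a) (interval a m) ++ lowerPart 0 (suc a) ++ upperPart 1 a
      ≡⟨ List.++-assoc (concatMap (Φ a) (interval a m)) _ _ ⟨
    (concatMap (Φ a) (interval a m) ++ lowerPart 0 (suc a)) ++ upperPart 1 a
      ≡⟨ cong (λ I → concatMap (λ g → concatMap (Φ g) (interval g m)) I ++ upperPart 1 a) (interval-cons {a} {m} e) ⟨
    lowerPart 0 a ++ upperPart 1 a               ∎
    where open PermutationReasoning

  rectangle-split-step zero    b e = ↭-reflexive (trans (cong (concatMap _) (interval-empty-suc {b} {m} e))
    (sym (cong₂ _++_ (cong (concatMap _) (interval-empty-suc {b} {m} e)) (cong (concatMap _) (interval-empty {b} {m} e)))))
  rectangle-split-step (suc k) b e = begin
    rectangle (suc b) b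
      ≡⟨ List.concatMap-cong (λ g → cong (concatMap (Φ g)) (interval-cons {b} {m} e)) (interval (suc b) m) ⟩
    concatMap (λ g → Φ g b ++ concatMap (Φ g) (interval (suc b) m)) (interval (suc b) m)
      ↭⟨ concatMap-++-distrib (λ g → Φ g b) _ (interval (suc b) m) ⟩
    column ++ rectangle (suc b) (suc b)
      ↭⟨ ++⁺ˡ column (rectangle-split-square k (suc b) (∸-pred {m} {b} e)) ⟩
    column ++ lowerPart 0 (suc b) ++ upperPart 1 (suc b)
      ↭⟨ shifts column (lowerPart 0 (suc b)) ⟩
    lowerPart 0 (suc b) ++ column ++ upperPart 1 (suc b)
      ≡⟨ cong (λ I → lowerPart 0 (suc b) ++ concatMap (λ h → concatMap (λ g → Φ g h) (interval (suc h) m)) I)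
              (interval-cons {b} {m} e) ⟨
    lowerPart 0 (suc b) ++ upperPart 1 b  ∎
    where
    open PermutationReasoning
    column = concatMap (λ g → Φ g b) (interval (suc b) m)

-- In rectangle-split, the diagonal g = h goes to the lower part when e₁ = 0 and to the upper part when e₂ = 0.
data Split (a b : ℕ) : ℕ → ℕ → Set where
  weak-strict : a ≡ b ⊎ a ≡ suc b → Split a b 0 1
  strict-weak : b ≡ a ⊎ b ≡ suc a → Split a b 1 0

rectangle-split : ∀ {B : Set} m (Φ : ℕ → ℕ → List B) {a b e₁ e₂} → Split a b e₁ e₂ →
  rectangle m Φ a b ↭ lowerPart m Φ e₁ a ++ upperPart m Φ e₂ b
rectangle-split m Φ {a} (weak-strict (inj₁ refl)) = rectangle-split-square m Φ _ a refl
rectangle-split m Φ {b = b} (weak-strict (inj₂ refl)) = rectangle-split-step m Φ _ b refl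
rectangle-split m Φ {a} {b} (strict-weak b≈a) = begin
  rectangle m Φ a b                        ↭⟨ concatMap-comm Φ (interval a m) (interval b m) ⟩
  rectangle m Ψ b a                        ↭⟨ rectangle-split m Ψ (weak-strict b≈a) ⟩
  lowerPart m Ψ 0 b ++ upperPart m Ψ 1 a   ↭⟨ ++-comm (lowerPart m Ψ 0 b) _ ⟩
  lowerPart m Φ 1 a ++ upperPart m Φ 0 b   ∎
  where
  open PermutationReasoning
  Ψ = λ h g → Φ g h

-- Compatible sequences and the shuffle product

-- compatibleSums p v (u₁ ⋯ uₙ) m lists g₁ + ⋯ + gₙ over all v ≤ g₁ ≤ ⋯ ≤ gₙ ≤ m with
-- g_{i-1} < g_i whenever u_i <c u_{i-1} (where u₀ = p, g₀ = v): the P-partitions of the word.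
compatibleSums : ∀ {r} → Letter r → ℕ → Word r → ℕ → List ℕ
compatibleSums p v []      m = [ 0 ]
compatibleSums p v (u ∷ w) m =
  concatMap (λ g → map (g +_) (compatibleSums u g w m)) (interval (χ (u <c p) + v) m)

Apart : ∀ {r} → Word r → Word r → Set
Apart a b = All (λ x → All (λ y → proj₁ x ≢ proj₁ y) b) a

apart-tailˡ : ∀ {r} {x : Letter r} {xs b} → Apart (x ∷ xs) b → Apart xs b
apart-tailˡ (_ ∷ d) = d

apart-tailʳ : ∀ {r} {y : Letter r} {a ys} → Apart a (y ∷ ys) → Apart a ys
apart-tailʳ = All.map All.tail

apart-head : ∀ {r} {x y : Letter r} {xs ys} → Apart (x ∷ xs) (y ∷ ys) → proj₁ x ≢ proj₁ y
apart-head ((x≢y ∷ _) ∷ _) = x≢y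

adjacent : ∀ b₁ b₂ v → χ b₂ ≤ χ b₁ → χ b₁ + v ≡ χ b₂ + v ⊎ χ b₁ + v ≡ suc (χ b₂ + v)
adjacent false false v _ = inj₁ refl
adjacent true  false v _ = inj₂ refl
adjacent true  true  v _ = inj₁ refl

first-letters-split : ∀ {r} (x y p : Letter r) v → proj₁ x ≢ proj₁ y →
  Split (χ (x <c p) + v) (χ (y <c p) + v) (χ (y <c x)) (χ (x <c y))
first-letters-split x y p v x≢y with x <c y in x<y | y <c x in y<x
... | true  | false = weak-strict (adjacent (x <c p) (y <c p) v (χ-<c-antitone x y p (subst T (sym x<y) _)))
... | false | true  = strict-weak (adjacent (y <c p) (x <c p) v (χ-<c-antitone y x p (subst T (sym y<x) _)))
... | true  | true  = ⊥-elim (≺-asym (<c⇒≺ x y (subst T (sym x<y) _)) (<c⇒≺ y x (subst T (sym y<x) _)))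
... | false | false = ⊥-elim (subst T y<x (≺⇒<c y x (≺-connex x y x≢y (subst T x<y ∘ ≺⇒<c x y))))

shift-⊞-concatMap : {X : Set} (g : ℕ) (A : List ℕ) (B : X → List ℕ) (L : List X) →
  map (g +_) (A ⊞ concatMap B L) ↭ concatMap (λ h → map (g +_) A ⊞ B h) L
shift-⊞-concatMap g A B L = begin
  map (g +_) (A ⊞ concatMap B L)               ↭⟨ map⁺ (g +_) (⊞-concatMapʳ A B L) ⟩
  map (g +_) (concatMap (λ h → A ⊞ B h) L)     ≡⟨ List.map-concatMap (g +_) (λ h → A ⊞ B h) L ⟩
  concatMap (λ h → map (g +_) (A ⊞ B h)) L     ≡⟨ List.concatMap-cong (λ h → ⊞-shiftˡ g A (B h)) L ⟨
  concatMap (λ h → map (g +_) A ⊞ B h) L       ∎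
  where open PermutationReasoning

module _ {r : ℕ} (m : ℕ) where

  private
    S : Letter r → ℕ → Word r → List ℕ
    S p v w = compatibleSums p v w m

  first-letter-sums : ∀ p v x xs (U : Word r) (cs : List (Word r)) →
    (∀ g → S x g xs ⊞ S x g U ↭ concatMap (S x g) cs) →
    concatMap (λ c → S p v (x ∷ c)) cs ↭
    concatMap (λ g → map (g +_) (S x g xs ⊞ S x g U)) (interval (χ (x <c p) + v) m)
  first-letter-sums p v x xs U cs ih = begin
    concatMap (λ c → S p v (x ∷ c)) cs                 ↭⟨ concatMap-comm (λ c g → map (g +_) (S x g c)) cs I ⟩
    concatMap (λ g → concatMap (λ c → map (g +_) (S x g c)) cs) I
                                                       ≡⟨ List.concatMap-cong (λ g → List.map-concatMap (g +_) (S x g) cs) I ⟨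
    concatMap (λ g → map (g +_) (concatMap (S x g) cs)) I
                                                       ↭⟨ concatMap-cong↭ (λ g → map⁺ (g +_) (↭-sym (ih g))) I ⟩
    concatMap (λ g → map (g +_) (S x g xs ⊞ S x g U)) I ∎
    where
    open PermutationReasoning
    I = interval (χ (x <c p) + v) m

  compatibleSums-shuffle : ∀ p v (a b : Word r) → Apart a b →
    S p v a ⊞ S p v b ↭ concatMap (S p v) (shuffles a b)
  compatibleSums-shuffle p v []       b        _ = ↭-reflexive (trans (⊞-identityˡ _) (sym (List.++-identityʳ _)))
  compatibleSums-shuffle p v (x ∷ xs) []       _ = ↭-reflexive (trans (⊞-identityʳ _) (sym (List.++-identityʳ _)))
  compatibleSums-shuffle p v (x ∷ xs) (y ∷ ys) d = begin
    S p v (x ∷ xs) ⊞ S p v (y ∷ ys)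
      ≡⟨ ⊞-concatMapˡ (λ g → map (g +_) (A g)) (interval a m) (S p v (y ∷ ys)) ⟩
    concatMap (λ g → map (g +_) (A g) ⊞ S p v (y ∷ ys)) (interval a m)
      ↭⟨ concatMap-cong↭ (λ g → ⊞-concatMapʳ (map (g +_) (A g)) (λ h → map (h +_) (B h)) (interval b m)) (interval a m) ⟩
    rectangle m Φ a b
      ↭⟨ rectangle-split m Φ (first-letters-split x y p v (apart-head d)) ⟩
    lowerPart m Φ (χ (y <c x)) a ++ upperPart m Φ (χ (x <c y)) b
      ↭⟨ ++⁺ (x-first (λ g → compatibleSums-shuffle x g xs (y ∷ ys) (apart-tailˡ d)))
             (y-first (λ h → compatibleSums-shuffle y h (x ∷ xs) ys (apart-tailʳ d))) ⟨
    concatMap (λ c → S p v (x ∷ c)) xs⧢ys ++ concatMap (λ c → S p v (y ∷ c)) x∷xs⧢ys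
      ≡⟨ cong₂ _++_ (List.concatMap-map (S p v) (x ∷_) xs⧢ys) (List.concatMap-map (S p v) (y ∷_) x∷xs⧢ys) ⟨
    concatMap (S p v) (map (x ∷_) xs⧢ys) ++ concatMap (S p v) (map (y ∷_) x∷xs⧢ys)
      ≡⟨ List.concatMap-++ (S p v) (map (x ∷_) xs⧢ys) (map (y ∷_) x∷xs⧢ys) ⟨
    concatMap (S p v) (shuffles (x ∷ xs) (y ∷ ys)) ∎
    where
    open PermutationReasoning
    A = λ g → S x g xs
    B = λ h → S y h ys
    a = χ (x <c p) + v
    b = χ (y <c p) + v
    Φ = λ g h → map (g +_) (A g) ⊞ map (h +_) (B h)
    xs⧢ys = shuffles xs (y ∷ ys)
    x∷xs⧢ys = shuffles (x ∷ xs) ys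
    x-first : (∀ g → A g ⊞ S x g (y ∷ ys) ↭ concatMap (S x g) xs⧢ys) →
      concatMap (λ c → S p v (x ∷ c)) xs⧢ys ↭ lowerPart m Φ (χ (y <c x)) a
    x-first ih = ↭-trans (first-letter-sums p v x xs (y ∷ ys) xs⧢ys ih)
      (concatMap-cong↭ (λ g → shift-⊞-concatMap g (A g) (λ h → map (h +_) (B h)) (interval (χ (y <c x) + g) m))
                       (interval a m))
    y-first : (∀ h → S y h (x ∷ xs) ⊞ B h ↭ concatMap (S y h) x∷xs⧢ys) →
      concatMap (λ c → S p v (y ∷ c)) x∷xs⧢ys ↭ upperPart m Φ (χ (x <c y)) b
    y-first ih = ↭-trans
      (first-letter-sums p v y ys (x ∷ xs) x∷xs⧢ys (λ h → ↭-trans (⊞-comm (B h) (S y h (x ∷ xs))) (ih h)))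
      (concatMap-cong↭ (λ h → ↭-trans (shift-⊞-concatMap h (B h) (λ g → map (g +_) (A g)) (interval (χ (x <c y) + h) m))
                                      (concatMap-cong↭ (λ g → ⊞-comm (map (h +_) (B h)) (map (g +_) (A g)))
                                                       (interval (χ (x <c y) + h) m)))
                       (interval b m))

-- The closed form of compatible sums

segment-bounds : ∀ a l → All (λ g → a ≤ g × g < a + l) (segment a l)
segment-bounds a zero    = []
segment-bounds a (suc l) = (≤-refl , m<m+n a z<s)
  ∷ All.map (λ {g} (a<g , g<) → <⇒≤ a<g , subst (g <_) (sym (+-suc a l)) g<) (segment-bounds (suc a) l)

interval-bounds : ∀ a m → All (λ g → a ≤ g × g ≤ m) (interval a m)
interval-bounds a m = All.map (λ (a≤g , g<) → a≤g , ≤-pred (upper a≤g g<)) (segment-bounds a (suc m ∸ a))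
  where
  upper : ∀ {g} → a ≤ g → g < a + (suc m ∸ a) → g < suc m
  upper {g} a≤g g< with a ≤? suc m
  ... | yes a≤1+m = subst (g <_) (m+[n∸m]≡n a≤1+m) g<
  ... | no  a≰1+m = ⊥-elim (<⇒≱ (subst (g <_) a+0≡a g<) a≤g)
    where a+0≡a = trans (cong (a +_) (m≤n⇒m∸n≡0 (<⇒≤ (≰⇒> a≰1+m)))) (+-identityʳ a)

segment-++ : ∀ a l₁ l₂ → segment a (l₁ + l₂) ≡ segment a l₁ ++ segment (a + l₁) l₂
segment-++ a zero     l₂ = cong (λ b → segment b l₂) (sym (+-identityʳ a))
segment-++ a (suc l₁) l₂ = cong (a ∷_) (trans (segment-++ (suc a) l₁ l₂)
  (cong (λ b → segment (suc a) l₁ ++ segment b l₂) (sym (+-suc a l₁))))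

segment-shift : ∀ a b l → segment (a + b) l ≡ map (a +_) (segment b l)
segment-shift a b zero    = refl
segment-shift a b (suc l) = cong (a + b ∷_) (trans (cong (λ c → segment c l) (sym (+-suc a b))) (segment-shift a (suc b) l))

segment-from-0 : ∀ a l → segment a l ≡ map (a +_) (segment 0 l)
segment-from-0 a l = trans (cong (λ b → segment b l) (sym (+-identityʳ a))) (segment-shift a 0 l)

applyUpTo≡map-segment : {B : Set} (f : ℕ → B) (l : ℕ) → applyUpTo f l ≡ map f (segment 0 l)
applyUpTo≡map-segment f zero    = refl
applyUpTo≡map-segment f (suc l) = cong (f 0 ∷_) (begin
  applyUpTo (f ∘ suc) l           ≡⟨ applyUpTo≡map-segment (f ∘ suc) l ⟩
  map (f ∘ suc) (segment 0 l)     ≡⟨ List.map-∘ (segment 0 l) ⟩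
  map f (map suc (segment 0 l))   ≡⟨ cong (map f) (segment-from-0 1 l) ⟨
  map f (segment 1 l)             ∎)
  where open ≡-Reasoning

upTo≡segment : ∀ l → upTo l ≡ segment 0 l
upTo≡segment l = trans (applyUpTo≡map-segment (λ x → x) l) (List.map-id (segment 0 l))

segment-reverse : {B : Set} (K : ℕ) (f : ℕ → List B) →
  concatMap f (segment 0 (suc K)) ↭ concatMap (λ j → f (K ∸ j)) (segment 0 (suc K))
segment-reverse zero    f = ↭-refl
segment-reverse (suc K) f = begin
  f 0 ++ concatMap f (segment 1 (suc K))
    ≡⟨ cong (f 0 ++_) (trans (cong (concatMap f) (segment-from-0 1 (suc K))) (List.concatMap-map f suc (segment 0 (suc K)))) ⟩
  f 0 ++ concatMap (f ∘ suc) (segment 0 (suc K))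
    ↭⟨ ++⁺ˡ (f 0) (segment-reverse K (f ∘ suc)) ⟩
  f 0 ++ concatMap (λ j → f (suc (K ∸ j))) (segment 0 (suc K))
    ↭⟨ ++⁺ˡ (f 0) (concatMap-congᴬ (All.map (λ (_ , j<) → ↭-reflexive (cong f (sym (+-∸-assoc 1 (≤-pred j<)))))
                                             (segment-bounds 0 (suc K)))) ⟩
  f 0 ++ reversed
    ↭⟨ ++-comm (f 0) reversed ⟩
  reversed ++ f 0
    ≡⟨ cong (reversed ++_) (trans (sym (List.++-identityʳ (f 0))) (cong (λ i → f i ++ []) (sym (n∸n≡0 K)))) ⟩
  reversed ++ concatMap (λ j → f (suc K ∸ j)) (segment (suc K) 1)
    ≡⟨ List.concatMap-++ (λ j → f (suc K ∸ j)) (segment 0 (suc K)) (segment (suc K) 1) ⟨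
  concatMap (λ j → f (suc K ∸ j)) (segment 0 (suc K) ++ segment (suc K) 1)
    ≡⟨ cong (concatMap (λ j → f (suc K ∸ j))) (trans (cong (segment 0) (+-comm 1 (suc K))) (segment-++ 0 (suc K) 1)) ⟨
  concatMap (λ j → f (suc K ∸ j)) (segment 0 (suc (suc K))) ∎
  where
  open PermutationReasoning
  reversed = concatMap (λ j → f (suc K ∸ j)) (segment 0 (suc K))

-- above d m f is the coefficient of t^m in t^d · Σₖ f k tᵏ.
above : {A : Set} → ℕ → ℕ → (ℕ → List A) → List A
above d m f with m <? d
... | yes _ = []
... | no  _ = f (m ∸ d)

above-< : ∀ {A : Set} {d m} (f : ℕ → List A) → m < d → above d m f ≡ []
above-< {d = d} {m} f m<d with m <? d
... | yes _   = refl
... | no  m≮d = ⊥-elim (m≮d m<d)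

above-≥ : ∀ {A : Set} {d m} (f : ℕ → List A) → d ≤ m → above d m f ≡ f (m ∸ d)
above-≥ {d = d} {m} f d≤m with m <? d
... | yes m<d = ⊥-elim (<⇒≱ m<d d≤m)
... | no  _   = refl

map-above : ∀ {A B : Set} (h : A → B) d m (f : ℕ → List A) → map h (above d m f) ≡ above d m (map h ∘ f)
map-above h d m f with m <? d
... | yes _ = refl
... | no  _ = refl

-- The t^m-coefficient of x^(vn+c) t^(v+d) / ((1-t)(1-xt)⋯(1-xⁿt)), as a multiset of x-exponents.
closedSums : ℕ → ℕ → ℕ → ℕ → ℕ → List ℕ
closedSums n d c v m = above (v + d) m (λ k → map (v * n + c +_) (geomExps n k))

geomExps-suc : ∀ n K → geomExps (suc n) K ≡
  concatMap (λ k → map (λ e → e + suc n * (K ∸ k)) (geomExps n k)) (segment 0 (suc K))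
geomExps-suc n K = cong (concatMap _) (upTo≡segment (suc K))

closedSums-shifted-term : ∀ n d c δ v K {j} → j ≤ K → let m = v + (δ + d) + K in
  map (δ + v + j +_) (closedSums n d c (δ + v + j) m) ≡
  map (v * suc n + (δ * suc n + c) +_) (map (λ e → e + suc n * (K ∸ (K ∸ j))) (geomExps n (K ∸ j)))
closedSums-shifted-term n d c δ v K {j} j≤K = begin
    map (a + j +_) (above (a + j + d) m (λ k → map ((a + j) * n + c +_) (geomExps n k)))
      ≡⟨ cong (map (a + j +_)) (trans (above-≥ _ start≤m) (cong (λ k → map ((a + j) * n + c +_) (geomExps n k)) remaining)) ⟩
    map (a + j +_) (map ((a + j) * n + c +_) (geomExps n (K ∸ j)))
      ≡⟨ List.map-∘ (geomExps n (K ∸ j)) ⟨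
    map (λ e → a + j + ((a + j) * n + c + e)) (geomExps n (K ∸ j))
      ≡⟨ List.map-cong (λ e → trans (exponent e) (cong (λ i → V + (e + suc n * i)) (sym (m∸[m∸n]≡n j≤K)))) _ ⟩
    map (λ e → V + (e + suc n * (K ∸ (K ∸ j)))) (geomExps n (K ∸ j))
      ≡⟨ List.map-∘ (geomExps n (K ∸ j)) ⟩
    map (V +_) (map (λ e → e + suc n * (K ∸ (K ∸ j))) (geomExps n (K ∸ j))) ∎
    where
    open ≡-Reasoning
    m = v + (δ + d) + K
    a = δ + v
    V = v * suc n + (δ * suc n + c)
    start≡ : a + j + d ≡ v + (δ + d) + j
    start≡ = rearrange δ v j d
      where
      rearrange : ∀ δ v j d → δ + v + j + d ≡ v + (δ + d) + j
      rearrange = solve-∀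
    start≤m : a + j + d ≤ m
    start≤m = subst (_≤ m) (sym start≡) (+-monoʳ-≤ (v + (δ + d)) j≤K)
    remaining : m ∸ (a + j + d) ≡ K ∸ j
    remaining = trans (cong (m ∸_) start≡) ([m+n]∸[m+o]≡n∸o (v + (δ + d)) K j)
    exponent : ∀ e → a + j + ((a + j) * n + c + e) ≡ V + (e + suc n * j)
    exponent e = rearrange δ v n c e j
      where
      rearrange : ∀ δ v n c e j → δ + v + j + ((δ + v + j) * n + c + e) ≡ v * suc n + (δ * suc n + c) + (e + suc n * j)
      rearrange = solve-∀

-- Summing the first factor 1/(1 - x^(n+1) t) as a geometric series over the first value g.
closedSums-step-≥ : ∀ n d c δ v K → let m = v + (δ + d) + K in
  concatMap (λ g → map (g +_) (closedSums n d c g m)) (interval (δ + v) m) ↭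
  closedSums (suc n) (δ + d) (δ * suc n + c) v m
closedSums-step-≥ n d c δ v K = begin
  concatMap term (interval a m)
    ≡⟨ cong (concatMap term) (trans (cong (segment a) interval-length) (segment-++ a (suc K) d)) ⟩
  concatMap term (segment a (suc K) ++ segment (a + suc K) d)
    ≡⟨ List.concatMap-++ term (segment a (suc K)) (segment (a + suc K) d) ⟩
  concatMap term (segment a (suc K)) ++ concatMap term (segment (a + suc K) d)
    ↭⟨ ++⁺ˡ (concatMap term (segment a (suc K))) (↭-trans (concatMap-congᴬ (All.map vanishing (segment-bounds (a + suc K) d)))
                                                          (↭-reflexive (concatMap-[] (segment (a + suc K) d)))) ⟩
  concatMap term (segment a (suc K)) ++ []
    ≡⟨ trans (List.++-identityʳ _) (trans (cong (concatMap term) (segment-from-0 a (suc K)))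
                                          (List.concatMap-map term (a +_) (segment 0 (suc K)))) ⟩
  concatMap (λ j → term (a + j)) (segment 0 (suc K))
    ↭⟨ concatMap-congᴬ (All.map (λ (_ , j<) → ↭-reflexive (closedSums-shifted-term n d c δ v K (≤-pred j<)))
                                (segment-bounds 0 (suc K))) ⟩
  concatMap (λ j → map (V +_) (G (K ∸ j))) (segment 0 (suc K))
    ↭⟨ segment-reverse K (λ k → map (V +_) (G k)) ⟨
  concatMap (λ k → map (V +_) (G k)) (segment 0 (suc K))
    ≡⟨ trans (cong (map (V +_)) (geomExps-suc n K)) (List.map-concatMap (V +_) G (segment 0 (suc K))) ⟨
  map (V +_) (geomExps (suc n) K)
    ≡⟨ trans (cong (λ k → map (V +_) (geomExps (suc n) k)) (sym (m+n∸m≡n (v + (δ + d)) K)))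
             (sym (above-≥ (λ k → map (V +_) (geomExps (suc n) k)) (m≤m+n (v + (δ + d)) K))) ⟩
  closedSums (suc n) (δ + d) (δ * suc n + c) v m ∎
  where
  open PermutationReasoning
  m = v + (δ + d) + K
  a = δ + v
  V = v * suc n + (δ * suc n + c)
  term = λ g → map (g +_) (closedSums n d c g m)
  G = λ k → map (λ e → e + suc n * (K ∸ k)) (geomExps n k)
  1+m≡ : suc m ≡ a + suc K + d
  1+m≡ = rearrange v δ d K
    where
    rearrange : ∀ v δ d K → suc (v + (δ + d) + K) ≡ δ + v + suc K + d
    rearrange = solve-∀
  interval-length : suc m ∸ a ≡ suc K + d
  interval-length = trans (cong (_∸ a) (trans 1+m≡ (+-assoc a (suc K) d))) (m+n∸m≡n a (suc K + d))
  vanishing : ∀ {g} → a + suc K ≤ g × g < a + suc K + d → term g ↭ []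
  vanishing {g} (a+1+K≤g , _) =
    ↭-reflexive (cong (map (g +_)) (above-< _ (≤-trans (≤-reflexive 1+m≡) (+-monoˡ-≤ d a+1+K≤g))))

closedSums-step : ∀ n d c δ v m →
  concatMap (λ g → map (g +_) (closedSums n d c g m)) (interval (δ + v) m) ↭
  closedSums (suc n) (δ + d) (δ * suc n + c) v m
closedSums-step n d c δ v m with v + (δ + d) ≤? m
... | yes s≤m = subst (λ m → concatMap (λ g → map (g +_) (closedSums n d c g m)) (interval (δ + v) m) ↭
                             closedSums (suc n) (δ + d) (δ * suc n + c) v m)
                      (m+[n∸m]≡n s≤m) (closedSums-step-≥ n d c δ v (m ∸ (v + (δ + d))))
... | no  s≰m = ↭-trans (concatMap-congᴬ (All.map vanishing (interval-bounds (δ + v) m)))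
                        (↭-reflexive (trans (concatMap-[] (interval (δ + v) m)) (sym (above-< _ m<s))))
  where
  m<s = ≰⇒> s≰m
  vanishing : ∀ {g} → δ + v ≤ g × g ≤ m → map (g +_) (closedSums n d c g m) ↭ []
  vanishing {g} (δ+v≤g , _) = ↭-reflexive (cong (map (g +_)) (above-< _ (<-≤-trans m<s
    (subst (_≤ g + d) (sym (rearrange v δ d)) (+-monoˡ-≤ d δ+v≤g)))))
    where
    rearrange : ∀ v δ d → v + (δ + d) ≡ δ + v + d
    rearrange = solve-∀

-- Descent number and comajor index of p · w, counting the descent p > w₁ but not the letter p itself.
desFrom : ∀ {r} → Letter r → Word r → ℕ
desFrom p []      = 0
desFrom p (u ∷ w) = χ (u <c p) + desFrom u w

comajFrom : ∀ {r} → Letter r → Word r → ℕ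
comajFrom p []      = 0
comajFrom p (u ∷ w) = χ (u <c p) * suc (length w) + comajFrom u w

compatibleSums-closed : ∀ {r} (p : Letter r) v (w : Word r) m → v ≤ m →
  compatibleSums p v w m ↭ closedSums (length w) (desFrom p w) (comajFrom p w) v m
compatibleSums-closed p v []      m v≤m = ↭-reflexive (sym (trans
  (above-≥ _ (subst (_≤ m) (sym (+-identityʳ v)) v≤m)) (cong (λ i → i + 0 + 0 ∷ []) (*-zeroʳ v))))
compatibleSums-closed p v (u ∷ w) m v≤m = ↭-trans
  (concatMap-congᴬ (All.map (λ {g} (_ , g≤m) → map⁺ (g +_) (compatibleSums-closed u g w m g≤m))
                            (interval-bounds (χ (u <c p) + v) m)))
  (closedSums-step (length w) (desFrom u w) (comajFrom u w) (χ (u <c p)) v m)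

-- The virtual initial letter 0⁰ turns the paper's descent at position 0 (γ₁ ≠ 0) into an ordinary descent.
p₀ : ∀ {r} → Letter (suc r)
p₀ = (0 , fzero)

initial-descent : ∀ {r} σ (γ : Fin (suc r)) →
  (if toℕ γ ≡ᵇ 0 then [] else [ 0 ]) ≡ (if (σ , γ) <c p₀ {r} then [ 0 ] else [])
initial-descent zero    γ with toℕ γ
... | zero  = refl
... | suc _ = refl
initial-descent (suc σ) γ with toℕ γ
... | zero  = refl
... | suc _ = refl

desPos-length : ∀ {r} i (u : Letter r) w → length (desPos i (u ∷ w)) ≡ desFrom u w
desPos-length i u []      = refl
desPos-length i u (y ∷ w) with y <c u
... | true  = cong suc (desPos-length (suc i) y w)
... | false = desPos-length (suc i) y w

desPos-comaj : ∀ {r} i (u : Letter r) w N → N ≡ i + length w → sum (map (N ∸_) (desPos i (u ∷ w))) ≡ comajFrom u w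
desPos-comaj i u []      N e = refl
desPos-comaj i u (y ∷ w) N e with y <c u
... | true  = cong₂ _+_ (trans (cong (_∸ i) e) (trans (m+n∸m≡n i (suc (length w))) (sym (*-identityˡ _))))
                        (desPos-comaj (suc i) y w N (trans e (+-suc i (length w))))
... | false = desPos-comaj (suc i) y w N (trans e (+-suc i (length w)))

length-if : ∀ b → length (if b then [ 0 ] else []) ≡ χ b
length-if true  = refl
length-if false = refl

comaj-if : ∀ b N → sum (map (N ∸_) (if b then [ 0 ] else [])) ≡ χ b * N
comaj-if true  N = refl
comaj-if false N = refl

des≡desFrom : ∀ {r} (w : Word (suc r)) → des w ≡ desFrom p₀ w
des≡desFrom []            = refl
des≡desFrom ((σ , γ) ∷ w) = trans (List.length-++ (if toℕ γ ≡ᵇ 0 then [] else [ 0 ]))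
  (cong₂ _+_ (trans (cong length (initial-descent σ γ)) (length-if ((σ , γ) <c p₀))) (desPos-length 1 (σ , γ) w))

comaj≡comajFrom : ∀ {r} (w : Word (suc r)) → comaj w ≡ comajFrom p₀ w
comaj≡comajFrom []            = refl
comaj≡comajFrom ((σ , γ) ∷ w) = begin
  sum (map (N ∸_) (head ++ desPos 1 ((σ , γ) ∷ w)))
    ≡⟨ cong sum (List.map-++ (N ∸_) head _) ⟩
  sum (map (N ∸_) head ++ map (N ∸_) (desPos 1 ((σ , γ) ∷ w)))
    ≡⟨ sum-++ (map (N ∸_) head) _ ⟩
  sum (map (N ∸_) head) + sum (map (N ∸_) (desPos 1 ((σ , γ) ∷ w)))
    ≡⟨ cong₂ _+_ (trans (cong (λ L → sum (map (N ∸_) L)) (initial-descent σ γ)) (comaj-if ((σ , γ) <c p₀) N))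
                 (desPos-comaj 1 (σ , γ) w N refl) ⟩
  comajFrom p₀ ((σ , γ) ∷ w) ∎
  where
  open ≡-Reasoning
  N = suc (length w)
  head = if toℕ γ ≡ᵇ 0 then [] else [ 0 ]

coeff-↭ : ∀ {r} {P Q : Poly r} → P ↭ Q → ∀ μ → coeff P μ ≡ coeff Q μ
coeff-↭ refl                 μ = refl
coeff-↭ (prep (q , ν) p)     μ = cong ((if does (ν ≟mono μ) then q else 0ℚ) +ℚ_) (coeff-↭ p μ)
coeff-↭ (swap (q₁ , ν₁) (q₂ , ν₂) p) μ = trans (sym (ℚ.+-assoc x y _))
  (trans (cong₂ _+ℚ_ (ℚ.+-comm x y) (coeff-↭ p μ)) (ℚ.+-assoc y x _))
  where
  x = if does (ν₁ ≟mono μ) then q₁ else 0ℚ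
  y = if does (ν₂ ≟mono μ) then q₂ else 0ℚ
coeff-↭ (_↭_.trans p q)      μ = trans (coeff-↭ p μ) (coeff-↭ q μ)

coeff-++ : ∀ {r} (P Q : Poly r) μ → coeff (P ++ Q) μ ≡ coeff P μ +ℚ coeff Q μ
coeff-++ []            Q μ = sym (ℚ.+-identityˡ _)
coeff-++ ((q , ν) ∷ P) Q μ = trans (cong ((if does (ν ≟mono μ) then q else 0ℚ) +ℚ_) (coeff-++ P Q μ))
  (sym (ℚ.+-assoc (if does (ν ≟mono μ) then q else 0ℚ) (coeff P μ) (coeff Q μ)))

coeff-scale : ∀ {r} c (P : Poly r) μ → coeff (polyScale c P) μ ≡ c *ℚ coeff P μ
coeff-scale c []            μ = sym (ℚ.*-zeroʳ c)
coeff-scale c ((q , ν) ∷ P) μ with ν ≟mono μ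
... | yes _ = trans (cong (c *ℚ q +ℚ_) (coeff-scale c P μ)) (sym (ℚ.*-distribˡ-+ c q (coeff P μ)))
... | no  _ = trans (ℚ.+-identityˡ _) (trans (coeff-scale c P μ) (cong (c *ℚ_) (sym (ℚ.+-identityˡ _))))

polyMul-++ˡ : ∀ {r} (P P′ Q : Poly r) → polyMul (P ++ P′) Q ≡ polyMul P Q ++ polyMul P′ Q
polyMul-++ˡ P P′ Q = List.concatMap-++ _ P P′

polyMul-↭ˡ : ∀ {r} {P P′ : Poly r} (Q : Poly r) → P ↭ P′ → polyMul P Q ↭ polyMul P′ Q
polyMul-↭ˡ Q = concatMap⁺ _

polyMul-↭ʳ : ∀ {r} (P : Poly r) {Q Q′ : Poly r} → Q ↭ Q′ → polyMul P Q ↭ polyMul P Q′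
polyMul-↭ʳ P Q↭Q′ = concatMap-cong↭ (λ { (q , (e , x)) → map⁺ _ Q↭Q′ }) P

monomial : ∀ {r} → Vec ℕ r → ℕ → ℚ × Mono r
monomial v e = (1ℚ , (v , e))

polyMul-monomials : ∀ {r} (u v : Vec ℕ r) X Y →
  polyMul (map (monomial u) X) (map (monomial v) Y) ≡ map (monomial (zipWith _+_ u v)) (X ⊞ Y)
polyMul-monomials u v []      Y = refl
polyMul-monomials u v (x ∷ X) Y = begin
  polyMul (monomial u x ∷ map (monomial u) X) (map (monomial v) Y)
    ≡⟨ polyMul-++ˡ [ monomial u x ] (map (monomial u) X) (map (monomial v) Y) ⟩
  polyMul [ monomial u x ] (map (monomial v) Y) ++ polyMul (map (monomial u) X) (map (monomial v) Y)
    ≡⟨ cong₂ _++_ (row Y) (polyMul-monomials u v X Y) ⟩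
  map (monomial uv) (map (x +_) Y) ++ map (monomial uv) (X ⊞ Y)
    ≡⟨ List.map-++ (monomial uv) (map (x +_) Y) (X ⊞ Y) ⟨
  map (monomial uv) ((x ∷ X) ⊞ Y) ∎
  where
  open ≡-Reasoning
  uv = zipWith _+_ u v
  row : ∀ Y → polyMul [ monomial u x ] (map (monomial v) Y) ≡ map (monomial uv) (map (x +_) Y)
  row []      = refl
  row (y ∷ Y) = cong (monomial uv (x + y) ∷_) (row Y)

sumS-concatMap : ∀ {r} (Ss : List (Series r)) m → sumS Ss m ≡ concatMap (λ S → S m) Ss
sumS-concatMap []       m = refl
sumS-concatMap (S ∷ Ss) m = cong (S m ++_) (sumS-concatMap Ss m)

shuffle↭++ : {A : Set} (a b : List A) → All (_↭ a ++ b) (shuffles a b)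
shuffle↭++ []       b        = ↭-refl ∷ []
shuffle↭++ (x ∷ xs) []       = ↭-sym (↭-reflexive (List.++-identityʳ (x ∷ xs))) ∷ []
shuffle↭++ (x ∷ xs) (y ∷ ys) = AllP.++⁺
  (AllP.map⁺ (All.map (prep x) (shuffle↭++ xs (y ∷ ys))))
  (AllP.map⁺ (All.map (λ c↭ → ↭-trans (prep y c↭) (↭-sym (shift y (x ∷ xs) ys))) (shuffle↭++ (x ∷ xs) ys)))

col-↭ : ∀ {r} {w w′ : Word r} → w ↭ w′ → col w ≡ col w′
col-↭ w↭w′ = Vec.tabulate-cong (λ j → ↭-length (filter-↭ (λ e → proj₂ e Fin.≟ j) w↭w′))

zipWith-+-tabulate : ∀ {n} (f g : Fin n → ℕ) → zipWith _+_ (tabulate f) (tabulate g) ≡ tabulate (λ j → f j + g j)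
zipWith-+-tabulate {zero}  f g = refl
zipWith-+-tabulate {suc n} f g = cong (f fzero + g fzero Vec.∷_) (zipWith-+-tabulate (f ∘ fsuc) (g ∘ fsuc))

col-++ : ∀ {r} (a b : Word r) → col (a ++ b) ≡ zipWith _+_ (col a) (col b)
col-++ a b = trans
  (Vec.tabulate-cong (λ j → trans (cong length (List.filter-++ (λ e → proj₂ e Fin.≟ j) a b))
                                  (List.length-++ (filter (λ e → proj₂ e Fin.≟ j) a))))
  (sym (zipWith-+-tabulate _ _))

col-shuffle : ∀ {r} (a b : Word r) → All (λ c → col c ≡ zipWith _+_ (col a) (col b)) (shuffles a b)
col-shuffle a b = All.map (λ c↭ → trans (col-↭ c↭) (col-++ a b)) (shuffle↭++ a b)

-- H is a homomorphism

Hᵏ : ∀ {r} → Key r → Series r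
Hᵏ (n , d , c , v) m = above d m (λ k → map (monomial v) (map (c +_) (geomExps n k)))

H≡Hᵏ : ∀ {r} (w : Word r) m → H w m ≡ Hᵏ (key w) m
H≡Hᵏ w m with m <? des w
... | yes _ = refl
... | no  _ = List.map-∘ (geomExps (length w) (m ∸ des w))

H-compatible : ∀ {r} (w : Word (suc r)) m → H w m ↭ map (monomial (col w)) (compatibleSums p₀ 0 w m)
H-compatible w m = begin
  H w m
    ≡⟨ trans (H≡Hᵏ w m) (cong₂ (λ d c → above d m (λ k → map (monomial (col w)) (map (c +_) (geomExps (length w) k))))
                                     (des≡desFrom w) (comaj≡comajFrom w)) ⟩
  above (desFrom p₀ w) m (map (monomial (col w)) ∘ λ k → map (comajFrom p₀ w +_) (geomExps (length w) k))
    ≡⟨ map-above (monomial (col w)) (desFrom p₀ w) m _ ⟨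
  map (monomial (col w)) (closedSums (length w) (desFrom p₀ w) (comajFrom p₀ w) 0 m)
    ↭⟨ map⁺ (monomial (col w)) (compatibleSums-closed p₀ 0 w m z≤n) ⟨
  map (monomial (col w)) (compatibleSums p₀ 0 w m) ∎
  where open PermutationReasoning

tabulate-const-0 : ∀ n → tabulate {n = n} (λ _ → 0) ≡ replicate n 0
tabulate-const-0 zero    = refl
tabulate-const-0 (suc n) = cong (0 Vec.∷_) (tabulate-const-0 n)

H-unit : ∀ {r} → H {r} [] ≈S oneS
H-unit {r} m μ = cong (λ P → coeff P μ) (begin
  H [] m                                               ≡⟨ H≡Hᵏ [] m ⟩
  above 0 m (λ k → map (monomial (col {r} [])) (geomExps 0 k)) ≡⟨ above-≥ {d = 0} {m} _ z≤n ⟩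
  [ monomial (col {r} []) 0 ]                          ≡⟨ cong (λ v → [ monomial v 0 ]) (tabulate-const-0 r) ⟩
  oneS m                                               ∎)
  where open ≡-Reasoning

H-shuffle : ∀ {r} (a b : Word (suc r)) → Apart a b → (H a ⊙ H b) ≈S sumS (map H (shuffles a b))
H-shuffle a b apart m = coeff-↭ (begin
  polyMul (H a m) (H b m)
    ↭⟨ ↭-trans (polyMul-↭ˡ (H b m) (H-compatible a m)) (polyMul-↭ʳ (map (monomial (col a)) (S a)) (H-compatible b m)) ⟩
  polyMul (map (monomial (col a)) (S a)) (map (monomial (col b)) (S b))
    ≡⟨ polyMul-monomials (col a) (col b) (S a) (S b) ⟩
  map (monomial (zipWith _+_ (col a) (col b))) (S a ⊞ S b)
    ↭⟨ map⁺ _ (compatibleSums-shuffle m p₀ 0 a b apart) ⟩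
  map (monomial (zipWith _+_ (col a) (col b))) (concatMap S (shuffles a b))
    ≡⟨ List.map-concatMap _ S (shuffles a b) ⟩
  concatMap (λ c → map (monomial (zipWith _+_ (col a) (col b))) (S c)) (shuffles a b)
    ↭⟨ concatMap-congᴬ (All.map (λ {c} e → ↭-reflexive (cong (λ v → map (monomial v) (S c)) (sym e))) (col-shuffle a b)) ⟩
  concatMap (λ c → map (monomial (col c)) (S c)) (shuffles a b)
    ↭⟨ concatMap-cong↭ (λ c → H-compatible c m) (shuffles a b) ⟨
  concatMap (λ c → H c m) (shuffles a b)
    ≡⟨ trans (sumS-concatMap (map H (shuffles a b)) m) (List.concatMap-map (λ T → T m) H (shuffles a b)) ⟨
  sumS (map H (shuffles a b)) m ∎)
  where
  open PermutationReasoning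
  S = λ c → compatibleSums p₀ 0 c m

0ℚ<1ℚ : 0ℚ ℚ< 1ℚ
0ℚ<1ℚ = toWitness {a? = 0ℚ ℚ.<? 1ℚ} _

ℕ→ℚ : ℕ → ℚ
ℕ→ℚ zero    = 0ℚ
ℕ→ℚ (suc n) = 1ℚ +ℚ ℕ→ℚ n

ℕ→ℚ-nonNegative : ∀ n → 0ℚ ℚ≤ ℕ→ℚ n
ℕ→ℚ-nonNegative zero    = ℚ.≤-refl
ℕ→ℚ-nonNegative (suc n) = ℚ.≤-trans (ℚ.≤-reflexive (sym (ℚ.+-identityˡ 0ℚ)))
                                     (ℚ.+-mono-≤ (ℚ.<⇒≤ 0ℚ<1ℚ) (ℕ→ℚ-nonNegative n))

ℕ→ℚ-suc≢0 : ∀ n → ℕ→ℚ (suc n) ≢ 0ℚ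
ℕ→ℚ-suc≢0 n e = ℚ.<⇒≢ 0<ℕ→ℚ[1+n] (sym e)
  where 0<ℕ→ℚ[1+n] = subst (_ℚ< 1ℚ +ℚ ℕ→ℚ n) (ℚ.+-identityˡ 0ℚ) (ℚ.+-mono-<-≤ 0ℚ<1ℚ (ℕ→ℚ-nonNegative n))

ℕ→ℚ-injective : ∀ a b → ℕ→ℚ a ≡ ℕ→ℚ b → a ≡ b
ℕ→ℚ-injective zero    zero    _ = refl
ℕ→ℚ-injective zero    (suc b) e = ⊥-elim (ℕ→ℚ-suc≢0 b (sym e))
ℕ→ℚ-injective (suc a) zero    e = ⊥-elim (ℕ→ℚ-suc≢0 a e)
ℕ→ℚ-injective (suc a) (suc b) e = cong suc (ℕ→ℚ-injective a b (cancel (ℕ→ℚ a) (ℕ→ℚ b) e))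
  where
  cancel : ∀ x y → 1ℚ +ℚ x ≡ 1ℚ +ℚ y → x ≡ y
  cancel x y e = trans (-1+1+ x) (trans (cong (- 1ℚ +ℚ_) e) (sym (-1+1+ y)))
    where
    -1+1+ : ∀ z → z ≡ - 1ℚ +ℚ (1ℚ +ℚ z)
    -1+1+ = solve 1 (λ z → z := (:- con 1ℚ) :+ (con 1ℚ :+ z)) refl

x+-y≡0⇒x≡y : ∀ x y → x +ℚ - y ≡ 0ℚ → x ≡ y
x+-y≡0⇒x≡y x y e = trans (rearrange x y) (trans (cong (_+ℚ y) e) (ℚ.+-identityˡ y))
  where
  rearrange : ∀ x y → x ≡ (x +ℚ - y) +ℚ y
  rearrange = solve 2 (λ x y → x := (x :+ (:- y)) :+ y) refl

if-false : {A : Set} {B : Set} (d : Dec A) → ¬ A → {x y : B} → (if does d then x else y) ≡ y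
if-false (yes a) ¬a = ⊥-elim (¬a a)
if-false (no  _) ¬a = refl

if-true : {A : Set} {B : Set} (d : Dec A) → A → {x y : B} → (if does d then x else y) ≡ x
if-true (yes _) _ = refl
if-true (no ¬a) a = ⊥-elim (¬a a)

module Combination {W K : Set} (κ : W → K) (_≟_ : DecidableEquality K) where

  classSum : List (ℚ × W) → K → ℚ
  classSum []            k = 0ℚ
  classSum ((q , w) ∷ L) k = (if does (κ w ≟ k) then q else 0ℚ) +ℚ classSum L k

  evaluate : (K → ℚ) → List (ℚ × W) → ℚ
  evaluate g []            = 0ℚ
  evaluate g ((q , w) ∷ L) = q *ℚ g (κ w) +ℚ evaluate g L

  dropClass : K → List (ℚ × W) → List (ℚ × W)
  dropClass k []            = []
  dropClass k ((q , w) ∷ L) = if does (κ w ≟ k) then dropClass k L else (q , w) ∷ dropClass k L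

  evaluate-dropClass : ∀ g k L → evaluate g L ≡ evaluate g (dropClass k L) +ℚ g k *ℚ classSum L k
  evaluate-dropClass g k [] = sym (trans (cong (0ℚ +ℚ_) (ℚ.*-zeroʳ (g k))) (ℚ.+-identityˡ 0ℚ))
  evaluate-dropClass g k ((q , w) ∷ L) with κ w ≟ k
  ... | yes refl = trans (cong (q *ℚ g (κ w) +ℚ_) (evaluate-dropClass g (κ w) L))
    (solve 4 (λ q X G s → q :* G :+ (X :+ G :* s) := X :+ G :* (q :+ s)) refl
             q (evaluate g (dropClass (κ w) L)) (g (κ w)) (classSum L (κ w)))
  ... | no  _    = trans (cong (q *ℚ g (κ w) +ℚ_) (evaluate-dropClass g k L))
    (solve 4 (λ a X G s → a :+ (X :+ G :* s) := (a :+ X) :+ G :* (con 0ℚ :+ s)) refl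
             (q *ℚ g (κ w)) (evaluate g (dropClass k L)) (g k) (classSum L k))

  classSum-dropClass-self : ∀ k L → classSum (dropClass k L) k ≡ 0ℚ
  classSum-dropClass-self k []            = refl
  classSum-dropClass-self k ((q , w) ∷ L) with κ w ≟ k
  ... | yes _   = classSum-dropClass-self k L
  ... | no  κ≢k = trans (cong (_+ℚ classSum (dropClass k L) k) (if-false (κ w ≟ k) κ≢k))
                        (trans (ℚ.+-identityˡ _) (classSum-dropClass-self k L))

  classSum-dropClass-other : ∀ k k′ L → k′ ≢ k → classSum (dropClass k L) k′ ≡ classSum L k′
  classSum-dropClass-other k k′ []            _    = refl
  classSum-dropClass-other k k′ ((q , w) ∷ L) k′≢k with κ w ≟ k
  ... | no  _   = cong ((if does (κ w ≟ k′) then q else 0ℚ) +ℚ_) (classSum-dropClass-other k k′ L k′≢k)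
  ... | yes κ≡k = trans (classSum-dropClass-other k k′ L k′≢k)
      (sym (trans (cong (_+ℚ classSum L k′) (if-false (κ w ≟ k′) (λ κ≡k′ → k′≢k (trans (sym κ≡k′) κ≡k))))
                  (ℚ.+-identityˡ _)))

  length-dropClass : ∀ k L → length (dropClass k L) ≤ length L
  length-dropClass k []            = z≤n
  length-dropClass k ((q , w) ∷ L) with κ w ≟ k
  ... | yes _ = m≤n⇒m≤1+n (length-dropClass k L)
  ... | no  _ = s≤s (length-dropClass k L)

  length-dropClass-head : ∀ q w L → length (dropClass (κ w) ((q , w) ∷ L)) ≤ length L
  length-dropClass-head q w L with κ w ≟ κ w
  ... | yes _   = length-dropClass (κ w) L
  ... | no  κ≢κ = ⊥-elim (κ≢κ refl)

  evaluate-vanishes : ∀ g L → (∀ w → g (κ w) ≡ 0ℚ ⊎ classSum L (κ w) ≡ 0ℚ) → evaluate g L ≡ 0ℚ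
  evaluate-vanishes g L₀ = go (length L₀) L₀ ≤-refl
    where
    go : ∀ N L → length L ≤ N → (∀ w → g (κ w) ≡ 0ℚ ⊎ classSum L (κ w) ≡ 0ℚ) → evaluate g L ≡ 0ℚ
    go N       []             _         _      = refl
    go (suc N) ((q , w₀) ∷ L′) (s≤s |L′|≤N) vanish = begin
      evaluate g M                                       ≡⟨ evaluate-dropClass g k M ⟩
      evaluate g (dropClass k M) +ℚ g k *ℚ classSum M k  ≡⟨ cong₂ _+ℚ_ rest head ⟩
      0ℚ +ℚ 0ℚ                                           ≡⟨ ℚ.+-identityˡ 0ℚ ⟩
      0ℚ                                                 ∎
      where
      open ≡-Reasoning
      M = (q , w₀) ∷ L′
      k = κ w₀
      head : g k *ℚ classSum M k ≡ 0ℚ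
      head with vanish w₀
      ... | inj₁ g≡0 = trans (cong (_*ℚ classSum M k) g≡0) (ℚ.*-zeroˡ (classSum M k))
      ... | inj₂ s≡0 = trans (cong (g k *ℚ_) s≡0) (ℚ.*-zeroʳ (g k))
      vanish′ : ∀ w → g (κ w) ≡ 0ℚ ⊎ classSum (dropClass k M) (κ w) ≡ 0ℚ
      vanish′ w with κ w ≟ k
      ... | yes κ≡k = inj₂ (subst (λ k′ → classSum (dropClass k M) k′ ≡ 0ℚ) (sym κ≡k) (classSum-dropClass-self k M))
      ... | no  κ≢k with vanish w
      ...   | inj₁ g≡0 = inj₁ g≡0
      ...   | inj₂ s≡0 = inj₂ (trans (classSum-dropClass-other k (κ w) M κ≢k) s≡0)
      rest : evaluate g (dropClass k M) ≡ 0ℚ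
      rest = go N (dropClass k M) (≤-trans (length-dropClass-head q w₀ L′) |L′|≤N) vanish′

  evaluate-+ : ∀ (g g′ : K → ℚ) L → evaluate (λ k → g k +ℚ g′ k) L ≡ evaluate g L +ℚ evaluate g′ L
  evaluate-+ g g′ []            = sym (ℚ.+-identityˡ 0ℚ)
  evaluate-+ g g′ ((q , w) ∷ L) = trans (cong (q *ℚ (g (κ w) +ℚ g′ (κ w)) +ℚ_) (evaluate-+ g g′ L))
    (solve 5 (λ q a b X Y → q :* (a :+ b) :+ (X :+ Y) := (q :* a :+ X) :+ (q :* b :+ Y)) refl
             q (g (κ w)) (g′ (κ w)) (evaluate g L) (evaluate g′ L))

  evaluate-cong : ∀ {g g′ : K → ℚ} L → (∀ w → g (κ w) ≡ g′ (κ w)) → evaluate g L ≡ evaluate g′ L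
  evaluate-cong []            _   = refl
  evaluate-cong ((q , w) ∷ L) g≗g′ = cong₂ _+ℚ_ (cong (q *ℚ_) (g≗g′ w)) (evaluate-cong L g≗g′)

  evaluate-indicator : ∀ k L → evaluate (λ k′ → if does (k′ ≟ k) then 1ℚ else 0ℚ) L ≡ classSum L k
  evaluate-indicator k []            = refl
  evaluate-indicator k ((q , w) ∷ L) with κ w ≟ k
  ... | yes _ = cong₂ _+ℚ_ (ℚ.*-identityʳ q) (evaluate-indicator k L)
  ... | no  _ = cong₂ _+ℚ_ (ℚ.*-zeroʳ q) (evaluate-indicator k L)

  classSum-++ : ∀ A B k → classSum (A ++ B) k ≡ classSum A k +ℚ classSum B k
  classSum-++ []            B k = sym (ℚ.+-identityˡ _)
  classSum-++ ((q , w) ∷ A) B k = trans (cong ((if does (κ w ≟ k) then q else 0ℚ) +ℚ_) (classSum-++ A B k))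
    (sym (ℚ.+-assoc (if does (κ w ≟ k) then q else 0ℚ) (classSum A k) (classSum B k)))

  evaluate-++ : ∀ g A B → evaluate g (A ++ B) ≡ evaluate g A +ℚ evaluate g B
  evaluate-++ g []            B = sym (ℚ.+-identityˡ _)
  evaluate-++ g ((q , w) ∷ A) B = trans (cong (q *ℚ g (κ w) +ℚ_) (evaluate-++ g A B))
    (sym (ℚ.+-assoc (q *ℚ g (κ w)) (evaluate g A) (evaluate g B)))

  multiplicity : K → List W → ℕ
  multiplicity k []      = 0
  multiplicity k (w ∷ X) = χ (does (κ w ≟ k)) + multiplicity k X

  classSum-ones : ∀ X k → classSum (map (1ℚ ,_) X) k ≡ ℕ→ℚ (multiplicity k X)
  classSum-ones []      k = refl
  classSum-ones (w ∷ X) k with κ w ≟ k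
  ... | yes _ = cong (1ℚ +ℚ_) (classSum-ones X k)
  ... | no  _ = trans (ℚ.+-identityˡ _) (classSum-ones X k)

  classSum-minus-ones : ∀ X k → classSum (map (- 1ℚ ,_) X) k ≡ - ℕ→ℚ (multiplicity k X)
  classSum-minus-ones []      k = refl
  classSum-minus-ones (w ∷ X) k with κ w ≟ k
  ... | yes _ = trans (cong (- 1ℚ +ℚ_) (classSum-minus-ones X k)) (sym (ℚ.neg-distrib-+ 1ℚ (ℕ→ℚ (multiplicity k X))))
  ... | no  _ = trans (ℚ.+-identityˡ _) (classSum-minus-ones X k)

  evaluate-minus-ones : ∀ g X → evaluate g (map (- 1ℚ ,_) X) ≡ - evaluate g (map (1ℚ ,_) X)
  evaluate-minus-ones g []      = refl
  evaluate-minus-ones g (w ∷ X) = trans (cong (- 1ℚ *ℚ g (κ w) +ℚ_) (evaluate-minus-ones g X))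
    (solve 2 (λ a e → (:- con 1ℚ) :* a :+ (:- e) := :- (con 1ℚ :* a :+ e)) refl (g (κ w)) (evaluate g (map (1ℚ ,_) X)))

  private
    multiplicity-self : ∀ w X → multiplicity (κ w) (w ∷ X) ≡ suc (multiplicity (κ w) X)
    multiplicity-self w X with κ w ≟ κ w
    ... | yes _   = refl
    ... | no  κ≢κ = ⊥-elim (κ≢κ refl)

    extract : ∀ w Y → multiplicity (κ w) Y ≢ 0 →
      Σ W λ d → Σ (List W) λ Y′ →
        κ d ≡ κ w × map κ Y ↭ map κ (d ∷ Y′) × (∀ k → multiplicity k Y ≡ multiplicity k (d ∷ Y′))
    extract w []      m≢0 = ⊥-elim (m≢0 refl)
    extract w (y ∷ Y) m≢0 with κ y ≟ κ w
    ... | yes κy≡κw = y , Y , κy≡κw , ↭-refl , (λ _ → refl)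
    ... | no  _ with extract w Y m≢0
    ...   | d , Y′ , κd≡κw , Y↭ , mult = d , y ∷ Y′ , κd≡κw ,
            ↭-trans (prep (κ y) Y↭) (swap (κ y) (κ d) ↭-refl) ,
            (λ k → trans (cong (χ (does (κ y ≟ k)) +_) (mult k))
                         (+-comm-middle (χ (does (κ y ≟ k))) (χ (does (κ d ≟ k))) (multiplicity k Y′)))
      where
      +-comm-middle : ∀ a b c → a + (b + c) ≡ b + (a + c)
      +-comm-middle = solve-∀

  ↭-from-multiplicities : ∀ X Y → (∀ w → multiplicity (κ w) X ≡ multiplicity (κ w) Y) → map κ X ↭ map κ Y
  ↭-from-multiplicities []      []      _    = ↭-refl
  ↭-from-multiplicities []      (y ∷ Y) same = ⊥-elim (0≢1+n (trans (same y) (multiplicity-self y Y)))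
  ↭-from-multiplicities (x ∷ X) Y       same
    with extract x Y (λ m≡0 → 0≢1+n (trans (sym m≡0) (trans (sym (same x)) (multiplicity-self x X))))
  ... | d , Y′ , κd≡κx , Y↭ , mult = begin
    κ x ∷ map κ X   ≡⟨ cong (_∷ map κ X) κd≡κx ⟨
    κ d ∷ map κ X   ↭⟨ prep (κ d) (↭-from-multiplicities X Y′ same′) ⟩
    map κ (d ∷ Y′)  ↭⟨ Y↭ ⟨
    map κ Y         ∎
    where
    open PermutationReasoning
    same′ : ∀ w → multiplicity (κ w) X ≡ multiplicity (κ w) Y′
    same′ w = +-cancelˡ-≡ (χ (does (κ x ≟ κ w))) _ _
      (trans (same w) (trans (mult (κ w)) (cong (λ k → χ (does (k ≟ κ w)) + multiplicity (κ w) Y′) κd≡κx)))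

-- Injectivity of H

sum-replicate-0 : ∀ n → Vec.sum (replicate n 0) ≡ 0
sum-replicate-0 zero    = refl
sum-replicate-0 (suc n) = sum-replicate-0 n

sum-zipWith-+ : ∀ {n} (u v : Vec ℕ n) → Vec.sum (zipWith _+_ u v) ≡ Vec.sum u + Vec.sum v
sum-zipWith-+ Vec.[]       Vec.[]       = refl
sum-zipWith-+ (x Vec.∷ u) (y Vec.∷ v) = trans (cong (x + y +_) (sum-zipWith-+ u v)) (interchange x y (Vec.sum u) (Vec.sum v))
  where
  interchange : ∀ a b c d → a + b + (c + d) ≡ a + c + (b + d)
  interchange = solve-∀

indicator-sum : ∀ {n} (γ : Fin n) → Vec.sum (tabulate (λ j → χ (does (γ Fin.≟ j)))) ≡ 1
indicator-sum {suc n} fzero    = cong suc (trans (cong Vec.sum (tabulate-const-0 n)) (sum-replicate-0 n))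
indicator-sum {suc n} (fsuc γ) = indicator-sum γ

length-filter-[_] : {A : Set} {P : A → Set} (P? : ∀ x → Dec (P x)) (x : A) → length (filter P? [ x ]) ≡ χ (does (P? x))
length-filter-[ P? ] x with does (P? x)
... | true  = refl
... | false = refl

sum-col : ∀ {r} (w : Word r) → Vec.sum (col w) ≡ length w
sum-col {r} []      = trans (cong Vec.sum (tabulate-const-0 r)) (sum-replicate-0 r)
sum-col     (x ∷ w) = begin
  Vec.sum (col ([ x ] ++ w))                   ≡⟨ cong Vec.sum (col-++ [ x ] w) ⟩
  Vec.sum (zipWith _+_ (col [ x ]) (col w))    ≡⟨ sum-zipWith-+ (col [ x ]) (col w) ⟩
  Vec.sum (col [ x ]) + Vec.sum (col w)        ≡⟨ cong₂ _+_ singleton (sum-col w) ⟩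
  suc (length w)                               ∎
  where
  open ≡-Reasoning
  singleton : Vec.sum (col [ x ]) ≡ 1
  singleton = trans (cong Vec.sum (Vec.tabulate-cong (λ j → length-filter-[ (λ e → proj₂ e Fin.≟ j) ] x)))
                    (indicator-sum (proj₂ x))

col⇒length : ∀ {r} {w w′ : Word r} → col w ≡ col w′ → length w ≡ length w′
col⇒length {w = w} {w′} e = trans (sym (sum-col w)) (trans (cong Vec.sum e) (sum-col w′))

geomExps-0 : ∀ n → geomExps n 0 ≡ [ 0 ]
geomExps-0 zero    = refl
geomExps-0 (suc n) = trans (List.++-identityʳ _)
  (trans (cong (map (λ e → e + suc n * 0)) (geomExps-0 n)) (cong [_] (*-zeroʳ (suc n))))

Hᵏ-diagonal : ∀ {r} n d c (v : Vec ℕ r) → Hᵏ (n , d , c , v) d ≡ [ monomial v c ]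
Hᵏ-diagonal n d c v = begin
  above d d (λ k → map (monomial v) (map (c +_) (geomExps n k)))
    ≡⟨ above-≥ {d = d} {d} _ ≤-refl ⟩
  map (monomial v) (map (c +_) (geomExps n (d ∸ d)))
    ≡⟨ cong (λ k → map (monomial v) (map (c +_) (geomExps n k))) (n∸n≡0 d) ⟩
  map (monomial v) (map (c +_) (geomExps n 0))
    ≡⟨ cong (λ L → map (monomial v) (map (c +_) L)) (geomExps-0 n) ⟩
  [ monomial v (c + 0) ]
    ≡⟨ cong (λ e → [ monomial v e ]) (+-identityʳ c) ⟩
  [ monomial v c ] ∎
  where open ≡-Reasoning

does-⇔ : {A B : Set} → (A → B) → (B → A) → (a? : Dec A) (b? : Dec B) → does a? ≡ does b?
does-⇔ f g (yes a) (yes b) = refl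
does-⇔ f g (yes a) (no ¬b) = ⊥-elim (¬b (f a))
does-⇔ f g (no ¬a) (yes b) = ⊥-elim (¬a (g b))
does-⇔ f g (no ¬a) (no ¬b) = refl

Hᵏ-below : ∀ {r} n c (v : Vec ℕ r) {d m} → m < d → Hᵏ (n , d , c , v) m ≡ []
Hᵏ-below n c v {d} {m} = above-< {d = d} {m} (λ k → map (monomial v) (map (c +_) (geomExps n k)))

different-descents : ∀ {r} {k k′ : Key r} → proj₁ (proj₂ k) ≢ proj₁ (proj₂ k′) →
  (if does (k ≟key k′) then 1ℚ else 0ℚ) ≡ 0ℚ
different-descents {k = k} {k′} d≢d′ = if-false (k ≟key k′) (d≢d′ ∘ cong (proj₁ ∘ proj₂))

-- H is unitriangular with respect to the descent number.
Hᵏ-leading : ∀ {r} (k : Key r) n d c (v : Vec ℕ r) → (proj₂ (proj₂ (proj₂ k)) ≡ v → proj₁ k ≡ n) →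
  coeff (Hᵏ k d) (v , c) ≡
  (if does (proj₁ (proj₂ k) <? d) then coeff (Hᵏ k d) (v , c) else 0ℚ) +ℚ
  (if does (k ≟key (n , d , c , v)) then 1ℚ else 0ℚ)
Hᵏ-leading (n′ , d′ , c′ , v′) n d c v same-length with <-cmp d′ d
... | tri< d′<d _ _ = sym (trans
  (cong₂ _+ℚ_ (if-true (d′ <? d) d′<d) (different-descents {k = n′ , d′ , c′ , v′} {n , d , c , v} (<⇒≢ d′<d)))
  (ℚ.+-identityʳ _))
... | tri> _ _ d<d′ = trans (cong (λ P → coeff P (v , c)) (Hᵏ-below n′ c′ v′ d<d′))
  (sym (trans (cong₂ _+ℚ_ (if-false (d′ <? d) (<-asym d<d′))
                          (different-descents {k = n′ , d′ , c′ , v′} {n , d , c , v} (>⇒≢ d<d′)))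
              (ℚ.+-identityˡ 0ℚ)))
... | tri≈ _ refl _ = begin
  coeff (Hᵏ (n′ , d , c′ , v′) d) (v , c)
    ≡⟨ cong (λ P → coeff P (v , c)) (Hᵏ-diagonal n′ d c′ v′) ⟩
  (if does ((v′ , c′) ≟mono (v , c)) then 1ℚ else 0ℚ) +ℚ 0ℚ
    ≡⟨ ℚ.+-identityʳ _ ⟩
  (if does ((v′ , c′) ≟mono (v , c)) then 1ℚ else 0ℚ)
    ≡⟨ cong (λ b → if b then 1ℚ else 0ℚ)
            (does-⇔ mono⇒key key⇒mono ((v′ , c′) ≟mono (v , c)) ((n′ , d , c′ , v′) ≟key (n , d , c , v))) ⟩
  (if does ((n′ , d , c′ , v′) ≟key (n , d , c , v)) then 1ℚ else 0ℚ)
    ≡⟨ ℚ.+-identityˡ _ ⟨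
  0ℚ +ℚ (if does ((n′ , d , c′ , v′) ≟key (n , d , c , v)) then 1ℚ else 0ℚ)
    ≡⟨ cong (_+ℚ (if does ((n′ , d , c′ , v′) ≟key (n , d , c , v)) then 1ℚ else 0ℚ))
            (if-false (d <? d) (<-irrefl refl) {coeff (Hᵏ (n′ , d , c′ , v′) d) (v , c)}) ⟨
  (if does (d <? d) then coeff (Hᵏ (n′ , d , c′ , v′) d) (v , c) else 0ℚ) +ℚ
  (if does ((n′ , d , c′ , v′) ≟key (n , d , c , v)) then 1ℚ else 0ℚ) ∎
  where
  open ≡-Reasoning
  mono⇒key : (v′ , c′) ≡ (v , c) → (n′ , d , c′ , v′) ≡ (n , d , c , v)
  mono⇒key refl = cong (λ n → n , d , c , v) (same-length refl)
  key⇒mono : (n′ , d , c′ , v′) ≡ (n , d , c , v) → (v′ , c′) ≡ (v , c)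
  key⇒mono refl = refl

open module Classes {r : ℕ} = Combination {Word r} {Key r} key _≟key_

Hˡ : ∀ {r} → List (ℚ × Word r) → Series r
Hˡ L = sumS (map (λ { (q , w) → scaleS q (H w) }) L)

coeff-Hˡ : ∀ {r} (L : List (ℚ × Word r)) m μ → coeff (Hˡ L m) μ ≡ evaluate (λ k → coeff (Hᵏ k m) μ) L
coeff-Hˡ []            m μ = refl
coeff-Hˡ ((q , w) ∷ L) m μ = trans (coeff-++ (polyScale q (H w m)) (Hˡ L m) μ)
  (cong₂ _+ℚ_ (trans (coeff-scale q (H w m) μ) (cong (λ P → q *ℚ coeff P μ) (H≡Hᵏ w m))) (coeff-Hˡ L m μ))

class-vanishes : ∀ {r} (L : List (ℚ × Word r)) c → Hˡ L ≈S zeroS →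
  (∀ w → des w < des c → classSum L (key w) ≡ 0ℚ) → classSum L (key c) ≡ 0ℚ
class-vanishes L c HL≈0 lower-vanish = begin
  classSum L (key c)                                   ≡⟨ ℚ.+-identityˡ _ ⟨
  0ℚ +ℚ classSum L (key c)                             ≡⟨ cong₂ _+ℚ_ (sym lower-part) (sym (evaluate-indicator (key c) L)) ⟩
  evaluate lower L +ℚ evaluate indicator L             ≡⟨ evaluate-+ lower indicator L ⟨
  evaluate (λ k → lower k +ℚ indicator k) L            ≡⟨ evaluate-cong L leading ⟨
  evaluate (λ k → coeff (Hᵏ k d) μ) L                  ≡⟨ coeff-Hˡ L d μ ⟨
  coeff (Hˡ L d) μ                                     ≡⟨ HL≈0 d μ ⟩
  0ℚ                                                   ∎
  where
  open ≡-Reasoning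
  d = des c
  μ = (col c , comaj c)
  lower = λ k → if does (proj₁ (proj₂ k) <? d) then coeff (Hᵏ k d) μ else 0ℚ
  indicator = λ k → if does (k ≟key key c) then 1ℚ else 0ℚ
  leading : ∀ w → coeff (Hᵏ (key w) d) μ ≡ lower (key w) +ℚ indicator (key w)
  leading w = Hᵏ-leading (key w) (length c) d (comaj c) (col c) (col⇒length {w = w} {c})
  lower-part : evaluate lower L ≡ 0ℚ
  lower-part = evaluate-vanishes lower L vanish
    where
    vanish : ∀ w → lower (key w) ≡ 0ℚ ⊎ classSum L (key w) ≡ 0ℚ
    vanish w = by-cases (des w <? d)
      where
      by-cases : Dec (des w < d) → lower (key w) ≡ 0ℚ ⊎ classSum L (key w) ≡ 0ℚ
      by-cases (yes w<c) = inj₂ (lower-vanish w w<c)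
      by-cases (no  w≮c) = inj₁ (if-false (des w <? d) w≮c)

Hˡ-injective : ∀ {r} (L : List (ℚ × Word r)) → Hˡ L ≈S zeroS → ∀ c → classSum L (key c) ≡ 0ℚ
Hˡ-injective L HL≈0 c = by-descents (suc (des c)) c ≤-refl
  where
  by-descents : ∀ N c → des c < N → classSum L (key c) ≡ 0ℚ
  by-descents (suc N) c (s≤s des≤N) = class-vanishes L c HL≈0 (λ w w<c → by-descents N w (<-≤-trans w<c des≤N))

-- Shuffle compatibility

coeff-sumS-H : ∀ {r} (X : List (Word r)) m μ →
  coeff (sumS (map H X) m) μ ≡ evaluate (λ k → coeff (Hᵏ k m) μ) (map (1ℚ ,_) X)
coeff-sumS-H []      m μ = refl
coeff-sumS-H (c ∷ X) m μ = trans (coeff-++ (H c m) (sumS (map H X) m) μ)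
  (cong₂ _+ℚ_ (trans (cong (λ P → coeff P μ) (H≡Hᵏ c m)) (sym (ℚ.*-identityˡ _))) (coeff-sumS-H X m μ))

H-class-invariant : ∀ {r} (w w′ : Word r) → key w ≡ key w′ → ∀ m → H w m ≡ H w′ m
H-class-invariant w w′ same m = trans (H≡Hᵏ w m) (trans (cong (λ k → Hᵏ k m) same) (sym (H≡Hᵏ w′ m)))

-- The sums of the classes of the shuffles of a, b and of a′, b′ have the same image under H, hence agree.
shuffle-classes : ∀ {r} (a b a′ b′ : Word (suc r)) → Apart a b → Apart a′ b′ → key a ≡ key a′ → key b ≡ key b′ →
  map key (shuffles a b) ↭ map key (shuffles a′ b′)
shuffle-classes a b a′ b′ apart apart′ same-a same-b = ↭-from-multiplicities X Y same-multiplicity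
  where
  X = shuffles a b
  Y = shuffles a′ b′
  L = map (1ℚ ,_) X ++ map (- 1ℚ ,_) Y
  HL≈0 : Hˡ L ≈S zeroS
  HL≈0 m μ = begin
    coeff (Hˡ L m) μ
      ≡⟨ coeff-Hˡ L m μ ⟩
    evaluate f L
      ≡⟨ evaluate-++ f (map (1ℚ ,_) X) (map (- 1ℚ ,_) Y) ⟩
    evaluate f (map (1ℚ ,_) X) +ℚ evaluate f (map (- 1ℚ ,_) Y)
      ≡⟨ cong₂ _+ℚ_ (sym (coeff-sumS-H X m μ)) (trans (evaluate-minus-ones f Y) (cong -_ (sym (coeff-sumS-H Y m μ)))) ⟩
    coeff (sumS (map H X) m) μ +ℚ - coeff (sumS (map H Y) m) μ
      ≡⟨ cong (_+ℚ - coeff (sumS (map H Y) m) μ) product-invariant ⟩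
    coeff (sumS (map H Y) m) μ +ℚ - coeff (sumS (map H Y) m) μ
      ≡⟨ ℚ.+-inverseʳ (coeff (sumS (map H Y) m) μ) ⟩
    0ℚ ∎
    where
    open ≡-Reasoning
    f = λ k → coeff (Hᵏ k m) μ
    product-invariant : coeff (sumS (map H X) m) μ ≡ coeff (sumS (map H Y) m) μ
    product-invariant = trans (sym (H-shuffle a b apart m μ))
      (trans (cong (λ P → coeff P μ) (cong₂ polyMul (H-class-invariant a a′ same-a m) (H-class-invariant b b′ same-b m)))
             (H-shuffle a′ b′ apart′ m μ))
  same-multiplicity : ∀ c → multiplicity (key c) X ≡ multiplicity (key c) Y
  same-multiplicity c = ℕ→ℚ-injective _ _ (x+-y≡0⇒x≡y _ _ (begin
    ℕ→ℚ (multiplicity (key c) X) +ℚ - ℕ→ℚ (multiplicity (key c) Y)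
      ≡⟨ cong₂ _+ℚ_ (classSum-ones X (key c)) (classSum-minus-ones Y (key c)) ⟨
    classSum (map (1ℚ ,_) X) (key c) +ℚ classSum (map (- 1ℚ ,_) Y) (key c)
      ≡⟨ classSum-++ (map (1ℚ ,_) X) (map (- 1ℚ ,_) Y) (key c) ⟨
    classSum L (key c)
      ≡⟨ Hˡ-injective L HL≈0 c ⟩
    0ℚ ∎))
    where open ≡-Reasoning

shuffle-compatible : ∀ {r} (a b a′ b′ : Word (suc r)) → Apart a b → Apart a′ b′ → key a ≡ key a′ → key b ≡ key b′ →
  map st (shuffles a b) ↭ map st (shuffles a′ b′)
shuffle-compatible a b a′ b′ apart apart′ same-a same-b = begin
  map st (shuffles a b)              ≡⟨ List.map-∘ (shuffles a b) ⟩
  map proj₂ (map key (shuffles a b))  ↭⟨ map⁺ proj₂ (shuffle-classes a b a′ b′ apart apart′ same-a same-b) ⟩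
  map proj₂ (map key (shuffles a′ b′)) ≡⟨ List.map-∘ (shuffles a′ b′) ⟨
  map st (shuffles a′ b′)            ∎
  where open PermutationReasoning

disjoint⇒apart : ∀ {r} (a b : Word r) → (∀ {v} → v ∈ symbols a × v ∈ symbols b → ⊥) → Apart a b
disjoint⇒apart []       b disjoint = []
disjoint⇒apart (x ∷ xs) b disjoint = apart-from b (λ e v∈b → disjoint (here e , v∈b))
                                   ∷ disjoint⇒apart xs b (λ (v∈xs , v∈b) → disjoint (there v∈xs , v∈b))
  where
  apart-from : ∀ b → (∀ {v} → v ≡ proj₁ x → v ∈ symbols b → ⊥) → All (λ y → proj₁ x ≢ proj₁ y) b
  apart-from []      _        = []
  apart-from (y ∷ b) excluded = (λ e → excluded refl (here e)) ∷ apart-from b (λ e v∈b → excluded e (there v∈b))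

words : ∀ {r} → List (ℚ × CPerm r) → List (ℚ × Word r)
words = map (λ (q , a) → q , word a)

Hlin≡Hˡ : ∀ {r} (L : List (ℚ × CPerm r)) m → Hlin L m ≡ Hˡ (words L) m
Hlin≡Hˡ []            m = refl
Hlin≡Hˡ ((q , a) ∷ L) m = cong (scaleS q (H (word a)) m ++_) (Hlin≡Hˡ L m)

classCoeff≡classSum : ∀ {r} (L : List (ℚ × CPerm r)) c → classCoeff L c ≡ classSum (words L) (key (word c))
classCoeff≡classSum []            c = refl
classCoeff≡classSum ((q , a) ∷ L) c =
  cong ((if does (key (word a) ≟key key (word c)) then q else 0ℚ) +ℚ_) (classCoeff≡classSum L c)

theorem4p2 : (r : ℕ) → 1 ≤ r →
    ((a b a′ b′ : CPerm r) → SymDisjoint a b → SymDisjoint a′ b′ →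
      length (word a) ≡ length (word a′) → length (word b) ≡ length (word b′) →
      st (word a) ≡ st (word a′) → st (word b) ≡ st (word b′) →
      map st (shuffles (word a) (word b)) ↭ map st (shuffles (word a′) (word b′)))
    ×
    ((H {r} [] ≈S oneS)
     × ((a b : CPerm r) → SymDisjoint a b →
          (H (word a) ⊙ H (word b)) ≈S sumS (map H (shuffles (word a) (word b))))
     × ((L : List (ℚ × CPerm r)) → Hlin L ≈S zeroS →
          (c : CPerm r) → classCoeff L c ≡ 0ℚ))
theorem4p2 (suc r) _ =
  (λ a b a′ b′ disjoint disjoint′ |a|≡ |b|≡ st-a≡ st-b≡ →
    shuffle-compatible (word a) (word b) (word a′) (word b′)
      (disjoint⇒apart (word a) (word b) disjoint) (disjoint⇒apart (word a′) (word b′) disjoint′)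
      (cong₂ _,_ |a|≡ st-a≡) (cong₂ _,_ |b|≡ st-b≡)) ,
  H-unit ,
  (λ a b disjoint → H-shuffle (word a) (word b) (disjoint⇒apart (word a) (word b) disjoint)) ,
  (λ L HL≈0 c → trans (classCoeff≡classSum L c)
    (Hˡ-injective (words L) (λ m μ → trans (cong (λ P → coeff P μ) (sym (Hlin≡Hˡ L m))) (HL≈0 m μ)) (word c)))
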